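{- For any $m\in\mathbb N$, $\Lambda_{\mathscr F_m,\overline{\mathcal P}_{\le m}}\le 2$. Furthermore, for any $\delta\in(0,\frac12]$ there exist a bid history $\mathcal H$ and a valuation vector $\mathbf v$ such that $\Lambda_{\mathscr F_m,\overline{\mathcal P}_{\le m}}(\mathcal H,\mathbf v)\ge 2-\delta$. Thus the richness ratio of the class $\mathscr F_m$ is $\alpha=1/2$.
   Context: Uniform price auction with $K$ identical units, repeated over a finite bid history $\mathcal H=[\boldsymbol\beta_-^t]_{t\in[T]}$ of competing bids. A bidder has valuation $\mathbf v$: $v_1\ge\dots\ge v_M>0$, $w_j=\frac1j\sum_{\ell\le j}v_\ell$. An $m$-uniform strategy $\langle(b_1,q_1),\dots,(b_m,q_m)\rangle$ ($b_1>\dots>b_m>0$, positive integer $q_j$, $Q_j=\sum_{\ell\le j}q_\ell\le M$) is the bid vector with $q_1$ copies of $b_1$, then $q_2$ copies of $b_2$, etc. With competing bids $\boldsymbol\beta_-$, the $K$ highest bids win a unit each (ties in favor of the bidder), $x$ is the bidder's number of winning bids, the per-unit price $p$ is the $K$-th highest bid, $V(\mathbf b;\boldsymbol\beta_-)=\sum_{j\le x}v_j$, $P=px$. $\overline{\mathcal P}_{\le m}$ is the set of $k$-uniform strategies, $k\le m$, with $b_\ell=w_{Q_\ell}$ for all $\ell$. $\mathscr F_m=\mathscr F_m(\mathcal H)$ is the class of $k$-uniform strategies with $k\le m$ that are RoI feasible ($V\ge P$) in every round of $\mathcal H$. For classes $\mathscr B_c,\mathscr B$: $\Lambda_{\mathscr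 B_c,\mathscr B}(\mathcal H,\mathbf v)=\frac{\max_{\mathbf b\in\mathscr B_c}\sum_tV(\mathbf b;\boldsymbol\beta_-^t)}{\max_{\mathbf b'\in\mathscr B}\sum_tV(\mathbf b';\boldsymbol\beta_-^t)}$, and $\Lambda_{\mathscr B_c,\mathscr B}$ is the supremum over all valuation vectors and all bid histories of arbitrary length. If $\Lambda_{\mathscr B_c,\mathscr B}\le\lambda$ and for every small $\delta>0$ some $(\mathcal H,\mathbf v)$ attains $\Lambda(\mathcal H,\mathbf v)\ge\lambda-\delta$, the richness ratio of $\mathscr B_c$ (relative to $\mathscr B=\overline{\mathcal P}_{\le m}$) is $\alpha=1/\lambda$. -}

module Defs where

open import Data.Bool using (Bool; true; false; if_then_else_)
open import Data.Nat as ℕ using (ℕ; zero; suc)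
open import Data.Integer using (+_)
open import Data.Rational using (ℚ; 0ℚ; _+_; _*_; _/_; _≤_; _<_; _≤ᵇ_)
open import Data.Rational.Properties using (_<?_)
open import Data.List using (List; []; _∷_; _++_; take; length; filter; replicate; concatMap; foldr; map)
open import Data.List.Relation.Unary.All using (All)
open import Data.List.Relation.Unary.Linked using (Linked)
open import Data.Product using (_×_; _,_; proj₁; proj₂)
open import Data.Unit using (⊤)
open import Relation.Nullary using (does)
open import Relation.Binary.PropositionalEquality using (_≡_)

sumℚ : List ℚ → ℚ
sumℚ = foldr _+_ 0ℚ

insertDesc : ℚ → List ℚ → List ℚ
insertDesc x [] = x ∷ []
insertDesc x (y ∷ ys) = if y ≤ᵇ x then x ∷ y ∷ ys else y ∷ insertDesc x ys

sortDesc : List ℚ → List ℚ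
sortDesc = foldr insertDesc []

-- 0-based lookup with default 0
nthOr0 : ℕ → List ℚ → ℚ
nthOr0 _ [] = 0ℚ
nthOr0 zero (x ∷ xs) = x
nthOr0 (suc n) (x ∷ xs) = nthOr0 n xs

record Valuation (v : List ℚ) : Set where
  field
    nonempty   : 1 ℕ.≤ length v
    decreasing : Linked (λ a b → b ≤ a) v
    positive   : All (λ a → 0ℚ < a) v

-- w_j = (1/j) Σ_{ℓ ≤ j} v_ℓ  (w_0 := 0, never used)
avg : List ℚ → ℕ → ℚ
avg v zero = 0ℚ
avg v (suc n) = sumℚ (take (suc n) v) * ((+ 1) / suc n)

-- Strategies: ⟨(b_1,q_1),...,(b_k,q_k)⟩ as a list of pairs (b_ℓ , q_ℓ)

Strategy : Set
Strategy = List (ℚ × ℕ)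

totalQ : Strategy → ℕ
totalQ s = foldr (λ p acc → proj₂ p ℕ.+ acc) 0 s

record IsUniform (m : ℕ) (v : List ℚ) (s : Strategy) : Set where
  field
    kpos       : 1 ℕ.≤ length s
    k≤m        : length s ℕ.≤ m
    strictDec  : Linked (λ p p' → proj₁ p' < proj₁ p) s
    bidsPos    : All (λ p → 0ℚ < proj₁ p) s
    qtyPos     : All (λ p → 1 ℕ.≤ proj₂ p) s
    Q≤M        : totalQ s ℕ.≤ length v

bidVector : Strategy → List ℚ
bidVector = concatMap (λ p → replicate (proj₂ p) (proj₁ p))

countAbove : ℚ → List ℚ → ℕ
countAbove b cs = length (filter (λ c → b <? c) cs)

-- number of the bidder's bids among the K highest bids (ties favour the
-- bidder): the bidder's j-th highest bid (0-based) is ranked after its j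
-- own higher-or-equal bids and after every strictly higher competing bid.
winsFrom : ℕ → List ℚ → ℕ → List ℚ → ℕ
winsFrom K cs j [] = 0
winsFrom K cs j (b ∷ bs) =
  if j ℕ.+ countAbove b cs ℕ.<ᵇ K
  then suc (winsFrom K cs (suc j) bs)
  else winsFrom K cs (suc j) bs

units : ℕ → List ℚ → List ℚ → ℕ
units K cs bs = winsFrom K cs 0 bs

-- per-unit price: the K-th highest of all bids
price : ℕ → List ℚ → List ℚ → ℚ
price K cs bs = nthOr0 (K ℕ.∸ 1) (sortDesc (bs ++ cs))

value : ℕ → List ℚ → Strategy → List ℚ → ℚ
value K v s cs = sumℚ (take (units K cs (bidVector s)) v)

payment : ℕ → Strategy → List ℚ → ℚ
payment K s cs =
  price K cs (bidVector s) * ((+ units K cs (bidVector s)) / 1)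

-- Bid histories: each round is a list of competing bids (nonnegative,
-- at least K of them)

History : Set
History = List (List ℚ)

ValidHistory : ℕ → History → Set
ValidHistory K H = All (λ cs → (K ℕ.≤ length cs) × All (λ c → 0ℚ ≤ c) cs) H

totalValue : ℕ → List ℚ → History → Strategy → ℚ
totalValue K v H s = sumℚ (map (value K v s) H)

-- b_ℓ = w_{Q_ℓ} for all ℓ (acc = Q_{ℓ-1})
BidsAreAvgs : List ℚ → ℕ → Strategy → Set
BidsAreAvgs v acc [] = ⊤
BidsAreAvgs v acc ((b , q) ∷ s) = (b ≡ avg v (acc ℕ.+ q)) × BidsAreAvgs v (acc ℕ.+ q) s

InPbar : ℕ → List ℚ → Strategy → Set
InPbar m v s = IsUniform m v s × BidsAreAvgs v 0 s

RoIFeasible : ℕ → List ℚ → History → Strategy → Set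
RoIFeasible K v H s = All (λ cs → payment K s cs ≤ value K v s cs) H

InF : ℕ → ℕ → List ℚ → History → Strategy → Set
InF K m v H s = IsUniform m v s × RoIFeasible K v H s

module Submission where

-- In a round where an RoI-feasible strategy wins x ≥ 1 units at price p,
-- feasibility gives p ≤ w_x. Let (b, Q) be the block holding the x-th unit won: its bid
-- and its cumulative quantity. If b ≤ w_x, the largest y ≤ Q with b ≤ w_y satisfies
-- x ≤ y, and bidding w_y for y units still wins x units. Otherwise p < b, so the block is
-- not rationed, x = Q, and bidding w_Q for Q units wins x units. The m block ends and the
-- m such cutoffs, thinned out until their averages strictly decrease, are the levels of
-- two strategies in P̄ that together win, round by round, at least the value of the
-- RoI-feasible strategy; the better one wins at least half of its total.
--
-- Take T = 2m blocks of units, block k holding B^(2k) units of value B^(T-k),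
-- and for each k a round type, repeated B^(T-k) times, in which exactly the units up to
-- the end of block k can be won at price w of that quantity. The strategy whose level j
-- bids w at the end of block 2j for the units of blocks 2j and 2j+1 wins exactly this in
-- every round, collecting B^(2T) from each of the 2m round types. A level of a strategy
-- in P̄ bidding w_Q for Q units gains only in rounds whose target is at least Q, and the
-- geometric weights bound this by B^(2T+2)/(B-1)^2. With at most m levels the ratio
-- tends to 2 as B grows.

module Rationals where

  open import Defs
  open import Data.Nat.Base as ℕ using (ℕ; zero; suc; s≤s)
  import Data.Nat.Properties as ℕ
  open import Data.Nat.ListAction using (sum)
  open import Data.Integer.Base as ℤ using (+_; -[1+_]; +<+)
  import Data.Integer.Properties as ℤ
  open import Data.Rational.Base using (ℚ; mkℚ; 0ℚ; 1ℚ; _+_; _*_; _-_; _/_; _≤_; _<_; toℚᵘ; *<*)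
  import Data.Rational.Properties as ℚ
  open import Data.Rational.Unnormalised.Base as ℚᵘ using (mkℚᵘ; *≡*; *≤*)
  import Data.Rational.Unnormalised.Properties as ℚᵘ
  open import Data.Rational.Solver using (module +-*-Solver)
  open import Data.List.Base using ([]; _∷_; map; take)
  open import Data.List.Relation.Unary.All as All using (All; []; _∷_)
  import Data.List.Relation.Unary.All.Properties as All
  open import Data.Product.Base using (_,_; ∃-syntax)
  open import Data.Sum.Base using (inj₁; inj₂)
  open import Relation.Nullary using (¬_)
  open import Relation.Binary.PropositionalEquality
  open import Algebra.Bundles using (CommutativeMonoid)
  import Algebra.Properties.CommutativeSemigroup as CommutativeSemigroupProperties

  ι : ℕ → ℚ
  ι n = + n / 1

  1/suc : ℕ → ℚ
  1/suc n = + 1 / suc n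

  toℚᵘ-frac : ∀ a n → toℚᵘ (ι a * 1/suc n) ℚᵘ.≃ mkℚᵘ (+ a) n
  toℚᵘ-frac a n = ℚᵘ.≃-trans (ℚ.toℚᵘ-homo-* (ι a) (1/suc n))
    (ℚᵘ.≃-trans (ℚᵘ.*-cong (ℚ.toℚᵘ-fromℚᵘ (mkℚᵘ (+ a) 0)) (ℚ.toℚᵘ-fromℚᵘ (mkℚᵘ (+ 1) n)))
      (*≡* (cong₂ ℤ._*_ (ℤ.*-identityʳ (+ a)) (cong +_ (sym (ℕ.*-identityˡ (suc n)))))))

  *-1/suc-zero : ∀ a → ι a * 1/suc 0 ≡ ι a
  *-1/suc-zero a = ℚ.*-identityʳ (ι a)

  frac-mono-≤ : ∀ a m b n → a ℕ.* suc n ℕ.≤ b ℕ.* suc m → ι a * 1/suc m ≤ ι b * 1/suc n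
  frac-mono-≤ a m b n le = ℚ.toℚᵘ-cancel-≤
    (ℚᵘ.≤-respʳ-≃ (ℚᵘ.≃-sym (toℚᵘ-frac b n)) (ℚᵘ.≤-respˡ-≃ (ℚᵘ.≃-sym (toℚᵘ-frac a m))
      (*≤* (subst₂ ℤ._≤_ (ℤ.pos-* a (suc n)) (ℤ.pos-* b (suc m)) (ℤ.+≤+ le)))))

  frac-mono-< : ∀ a m b n → a ℕ.* suc n ℕ.< b ℕ.* suc m → ι a * 1/suc m < ι b * 1/suc n
  frac-mono-< a m b n lt = ℚ.toℚᵘ-cancel-<
    (ℚᵘ.<-respʳ-≃ (ℚᵘ.≃-sym (toℚᵘ-frac b n)) (ℚᵘ.<-respˡ-≃ (ℚᵘ.≃-sym (toℚᵘ-frac a m))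
      (ℚᵘ.*<* (subst₂ ℤ._<_ (ℤ.pos-* a (suc n)) (ℤ.pos-* b (suc m)) (ℤ.+<+ lt)))))

  ι-mono-≤ : ∀ {a b} → a ℕ.≤ b → ι a ≤ ι b
  ι-mono-≤ {a} {b} le = subst₂ _≤_ (*-1/suc-zero a) (*-1/suc-zero b)
    (frac-mono-≤ a 0 b 0 (subst₂ ℕ._≤_ (sym (ℕ.*-identityʳ a)) (sym (ℕ.*-identityʳ b)) le))

  ι-mono-< : ∀ {a b} → a ℕ.< b → ι a < ι b
  ι-mono-< {a} {b} lt = subst₂ _<_ (*-1/suc-zero a) (*-1/suc-zero b)
    (frac-mono-< a 0 b 0 (subst₂ ℕ._<_ (sym (ℕ.*-identityʳ a)) (sym (ℕ.*-identityʳ b)) lt))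

  ι-+ : ∀ a b → ι (a ℕ.+ b) ≡ ι a + ι b
  ι-+ a b = ℚ.toℚᵘ-injective (ℚᵘ.≃-sym (ℚᵘ.≃-trans (ℚ.toℚᵘ-homo-+ (ι a) (ι b))
    (ℚᵘ.≃-trans (ℚᵘ.+-cong (ℚ.toℚᵘ-fromℚᵘ (mkℚᵘ (+ a) 0)) (ℚ.toℚᵘ-fromℚᵘ (mkℚᵘ (+ b) 0)))
      (ℚᵘ.≃-trans (*≡* eq) (ℚᵘ.≃-sym (ℚ.toℚᵘ-fromℚᵘ (mkℚᵘ (+ (a ℕ.+ b)) 0)))))))
    where
    eq : (+ a ℤ.* + 1 ℤ.+ + b ℤ.* + 1) ℤ.* + 1 ≡ + (a ℕ.+ b) ℤ.* + 1
    eq = cong (ℤ._* + 1) (trans (cong₂ ℤ._+_ (ℤ.*-identityʳ (+ a)) (ℤ.*-identityʳ (+ b))) (sym (ℤ.pos-+ a b)))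

  ι-* : ∀ a b → ι (a ℕ.* b) ≡ ι a * ι b
  ι-* a b = ℚ.toℚᵘ-injective (ℚᵘ.≃-sym (ℚᵘ.≃-trans (ℚ.toℚᵘ-homo-* (ι a) (ι b))
    (ℚᵘ.≃-trans (ℚᵘ.*-cong (ℚ.toℚᵘ-fromℚᵘ (mkℚᵘ (+ a) 0)) (ℚ.toℚᵘ-fromℚᵘ (mkℚᵘ (+ b) 0)))
      (ℚᵘ.≃-trans (*≡* (cong (ℤ._* + 1) (sym (ℤ.pos-* a b)))) (ℚᵘ.≃-sym (ℚ.toℚᵘ-fromℚᵘ (mkℚᵘ (+ (a ℕ.* b)) 0)))))))

  ι-sum : ∀ xs → sumℚ (map ι xs) ≡ ι (sum xs)
  ι-sum [] = refl
  ι-sum (x ∷ xs) = trans (cong (λ s → ι x + s) (ι-sum xs)) (sym (ι-+ x (sum xs)))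

  ι-suc*1/suc : ∀ n → ι (suc n) * 1/suc n ≡ 1ℚ
  ι-suc*1/suc n = ℚ.toℚᵘ-injective (ℚᵘ.≃-trans (toℚᵘ-frac (suc n) n) (*≡* (ℤ.*-comm (+ suc n) (+ 1))))

  *-1/suc-*-ι : ∀ q n → q * 1/suc n * ι (suc n) ≡ q
  *-1/suc-*-ι q n = begin
    q * 1/suc n * ι (suc n)   ≡⟨ ℚ.*-assoc q (1/suc n) (ι (suc n)) ⟩
    q * (1/suc n * ι (suc n)) ≡⟨ cong (q *_) (trans (ℚ.*-comm (1/suc n) (ι (suc n))) (ι-suc*1/suc n)) ⟩
    q * 1ℚ                    ≡⟨ ℚ.*-identityʳ q ⟩
    q                         ∎
    where open ≡-Reasoning

  ≤-*-1/suc : ∀ p n S → p * ι (suc n) ≤ S → p ≤ S * 1/suc n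
  ≤-*-1/suc p n S le = subst (_≤ S * 1/suc n) cancel
    (ℚ.*-monoʳ-≤-nonNeg (1/suc n) {{ℚ.normalize-nonNeg 1 (suc n)}} le)
    where
    cancel : p * ι (suc n) * 1/suc n ≡ p
    cancel = trans (ℚ.*-assoc p (ι (suc n)) (1/suc n)) (trans (cong (p *_) (ι-suc*1/suc n)) (ℚ.*-identityʳ p))

  +-≤-2* : ∀ {a b} → a ≤ b → a + b ≤ ι 2 * b
  +-≤-2* {a} {b} a≤b = subst (a + b ≤_) b+b≡2b (ℚ.+-monoˡ-≤ b a≤b)
    where
    b+b≡2b : b + b ≡ ι 2 * b
    b+b≡2b = sym (trans (ℚ.*-distribʳ-+ b 1ℚ 1ℚ) (cong₂ _+_ (ℚ.*-identityˡ b) (ℚ.*-identityˡ b)))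

  module _ (f : ℕ → ℚ) (step : ∀ {y} → 1 ℕ.≤ y → f (suc y) < f y) where

    strictly-antitone : ∀ {y y′} → 1 ℕ.≤ y → y ℕ.< y′ → f y′ < f y
    strictly-antitone {y} {suc y″} 1≤y (ℕ.s≤s y≤y″) with ℕ.m≤n⇒m<n∨m≡n y≤y″
    ... | inj₂ refl = step 1≤y
    ... | inj₁ y<y″ = ℚ.<-trans (step (ℕ.≤-trans 1≤y (ℕ.<⇒≤ y<y″))) (strictly-antitone 1≤y y<y″)

    antitone : ∀ {y y′} → 1 ℕ.≤ y → y ℕ.≤ y′ → f y′ ≤ f y
    antitone 1≤y y≤y′ with ℕ.m≤n⇒m<n∨m≡n y≤y′
    ... | inj₁ y<y′ = ℚ.<⇒≤ (strictly-antitone 1≤y y<y′)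
    ... | inj₂ refl = ℚ.≤-refl

    antitone-reflects : ∀ {x Q} → 1 ℕ.≤ x → f x ≤ f Q → Q ℕ.≤ x
    antitone-reflects 1≤x fx≤fQ = ℕ.≮⇒≥ (λ x<Q → ℚ.<-irrefl refl (ℚ.<-≤-trans (strictly-antitone 1≤x x<Q) fx≤fQ))

  ℚ-≤⇒≯ : ∀ {a b} → a ≤ b → ¬ b < a
  ℚ-≤⇒≯ a≤b b<a = ℚ.<-irrefl refl (ℚ.<-≤-trans b<a a≤b)

  sumℚ-nonneg : ∀ {xs} → All (0ℚ ≤_) xs → 0ℚ ≤ sumℚ xs
  sumℚ-nonneg [] = ℚ.≤-refl
  sumℚ-nonneg (px ∷ pxs) = ℚ.+-mono-≤ px (sumℚ-nonneg pxs)

  sumℚ-take-mono : ∀ {xs} → All (0ℚ ≤_) xs → ∀ {m n} → m ℕ.≤ n → sumℚ (take m xs) ≤ sumℚ (take n xs)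
  sumℚ-take-mono pxs {zero} {n} _ = sumℚ-nonneg (All.take⁺ n pxs)
  sumℚ-take-mono [] {suc m} {suc n} _ = ℚ.≤-refl
  sumℚ-take-mono {x ∷ _} (_ ∷ pxs) {suc m} {suc n} (s≤s m≤n) = ℚ.+-monoʳ-≤ x (sumℚ-take-mono pxs m≤n)

  sumℚ-map-≤-+ : ∀ {A : Set} (f g h : A → ℚ) {xs} → All (λ a → f a ≤ g a + h a) xs →
                 sumℚ (map f xs) ≤ sumℚ (map g xs) + sumℚ (map h xs)
  sumℚ-map-≤-+ f g h [] = ℚ.≤-refl
  sumℚ-map-≤-+ f g h {a ∷ xs} (le ∷ les) = ℚ.≤-trans (ℚ.+-mono-≤ le (sumℚ-map-≤-+ f g h les))
    (ℚ.≤-reflexive (interchange (g a) (h a) (sumℚ (map g xs)) (sumℚ (map h xs))))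
    where open CommutativeSemigroupProperties (CommutativeMonoid.commutativeSemigroup ℚ.+-0-commutativeMonoid)

  nonneg : ∀ {v} → Valuation v → All (0ℚ ≤_) v
  nonneg val = All.map ℚ.<⇒≤ (Valuation.positive val)

  avg-pos : ∀ {v} → Valuation v → ∀ n → 0ℚ < avg v (suc n)
  avg-pos {v₁ ∷ v} val n = subst (_< avg (v₁ ∷ v) (suc n)) (ℚ.*-zeroˡ (1/suc n))
    (ℚ.*-monoˡ-<-pos (1/suc n) {{ℚ.normalize-pos 1 (suc n)}} (begin-strict
    0ℚ                          <⟨ All.head (Valuation.positive val) ⟩
    v₁                          ≡⟨ ℚ.+-identityʳ v₁ ⟨
    v₁ + 0ℚ                   ≤⟨ ℚ.+-monoʳ-≤ v₁ (sumℚ-nonneg (All.take⁺ n (All.tail (nonneg val)))) ⟩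
    sumℚ (take (suc n) (v₁ ∷ v)) ∎))
    where open ℚ.≤-Reasoning

  archimedean-4 : ∀ δ → 0ℚ < δ → ∃[ c ] ι 4 ≤ δ * ι (suc (suc c))
  archimedean-4 (mkℚ (+ zero) _ _) (*<* (+<+ ()))
  archimedean-4 (mkℚ -[1+ _ ] _ _) (*<* ())
  archimedean-4 δ@(mkℚ (+ suc n) d _) _ = 2 ℕ.+ 4 ℕ.* d , (begin
    ι 4                                         ≤⟨ ι-mono-≤ (ℕ.m≤n*m 4 (suc n)) ⟩
    ι (suc n ℕ.* 4)                             ≡⟨ ι-* (suc n) 4 ⟩
    ι (suc n) * ι 4                             ≡⟨ ℚ.*-identityʳ _ ⟨
    ι (suc n) * ι 4 * 1ℚ                        ≡⟨ cong (ι (suc n) * ι 4 *_) (trans (ℚ.*-comm (1/suc d) (ι (suc d))) (ι-suc*1/suc d)) ⟨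
    ι (suc n) * ι 4 * (1/suc d * ι (suc d))     ≡⟨ solve 4 (λ a f i e → a :* f :* (i :* e) := a :* i :* (f :* e)) refl
                                                     (ι (suc n)) (ι 4) (1/suc d) (ι (suc d)) ⟩
    ι (suc n) * 1/suc d * (ι 4 * ι (suc d))     ≡⟨ cong₂ _*_ δ≡ (trans (sym (ι-* 4 (suc d))) (cong ι B≡)) ⟩
    δ * ι (4 ℕ.+ 4 ℕ.* d)                      ∎)
    where
    open ℚ.≤-Reasoning
    open +-*-Solver
    δ≡ : ι (suc n) * 1/suc d ≡ δ
    δ≡ = ℚ.toℚᵘ-injective (toℚᵘ-frac (suc n) d)
    B≡ : 4 ℕ.* suc d ≡ 4 ℕ.+ 4 ℕ.* d
    B≡ = ℕ.*-suc 4 d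

  two-minus-≤ : ∀ δ c X Y → ι 4 ≤ δ * ι (suc (suc c)) → (c ℕ.+ c) ℕ.* X ℕ.≤ suc (suc c) ℕ.* Y →
                (ι 2 - δ) * ι X ≤ ι Y
  two-minus-≤ δ c X Y 4≤δB cX≤BY = ℚ.*-cancelˡ-≤-pos (ι B) {{ℚ.normalize-pos B 1}} (begin
    ι B * ((ι 2 - δ) * ι X)     ≡⟨ solve 4 (λ b t d x → b :* ((t :- d) :* x) := (t :* b :- d :* b) :* x) refl (ι B) (ι 2) δ (ι X) ⟩
    (ι 2 * ι B - δ * ι B) * ι X ≤⟨ ℚ.*-monoʳ-≤-nonNeg (ι X) {{ℚ.normalize-nonNeg X 1}}
                                     (ℚ.+-monoʳ-≤ (ι 2 * ι B) (ℚ.neg-antimono-≤ 4≤δB)) ⟩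
    (ι 2 * ι B - ι 4) * ι X     ≡⟨ cong (_* ι X) 2B-4 ⟩
    ι (c ℕ.+ c) * ι X           ≡⟨ ι-* (c ℕ.+ c) X ⟨
    ι ((c ℕ.+ c) ℕ.* X)         ≤⟨ ι-mono-≤ cX≤BY ⟩
    ι (B ℕ.* Y)                 ≡⟨ ι-* B Y ⟩
    ι B * ι Y                   ∎)
    where
    open ℚ.≤-Reasoning
    open +-*-Solver
    B = suc (suc c)
    2B-4 : ι 2 * ι B - ι 4 ≡ ι (c ℕ.+ c)
    2B-4 = begin-equality
      ι 2 * ι B - ι 4               ≡⟨ cong (_- ι 4) (trans (sym (ι-* 2 B)) (trans (cong ι 2B≡) (ι-+ (c ℕ.+ c) 4))) ⟩
      ι (c ℕ.+ c) + ι 4 - ι 4       ≡⟨ solve 2 (λ a b → a :+ b :- b := a) refl (ι (c ℕ.+ c)) (ι 4) ⟩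
      ι (c ℕ.+ c)                   ∎
      where
      2B≡ : 2 ℕ.* B ≡ c ℕ.+ c ℕ.+ 4
      2B≡ = trans (cong (λ n → suc (suc n)) (trans (ℕ.+-suc c _) (cong suc (trans (ℕ.+-suc c _)
              (cong (λ n → suc (c ℕ.+ n)) (ℕ.+-identityʳ c))))))
            (ℕ.+-comm 4 (c ℕ.+ c))

module Auctions where

  open import Defs
  open Rationals using (ℚ-≤⇒≯)
  open import Data.Bool.Base using (true; false; T)
  open import Data.Nat.Base using (ℕ; zero; suc; z≤n; s≤s; _+_; _∸_; _≤_; _<_; _<ᵇ_)
  import Data.Nat.Properties as ℕ
  open import Data.Rational.Base as ℚ using (ℚ; _≤ᵇ_)
  import Data.Rational.Properties as ℚ
  open import Data.Rational.Properties using (_<?_; _≤?_)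
  open import Data.List.Base using (List; []; _∷_; _++_; length; filter; replicate)
  import Data.List.Properties as List
  open import Data.List.Relation.Unary.All as All using (All; []; _∷_)
  import Data.List.Relation.Unary.All.Properties as All
  open import Data.List.Relation.Unary.Linked using (Linked; []; [-]; _∷_)
  import Data.List.Relation.Unary.Linked as Linked
  import Data.List.Relation.Unary.Linked.Properties as Linked
  open import Data.List.Relation.Binary.Permutation.Propositional using (_↭_; ↭-refl; ↭-sym; ↭-trans; prep; swap)
  open import Data.List.Relation.Binary.Permutation.Propositional.Properties using (↭-length; filter-↭; All-resp-↭)
  open import Data.Product.Base using (_×_; _,_; proj₁)
  open import Data.Sum.Base using (_⊎_; inj₁; inj₂)
  open import Function.Base using (_∘_)
  open import Level using (0ℓ)
  open import Relation.Binary.Core using (Rel)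
  open import Relation.Binary.Definitions using (Reflexive; Transitive)
  open import Relation.Nullary using (¬_; Dec; yes; no)
  open import Relation.Nullary.Negation using (contradiction)
  open import Relation.Unary using (Pred; Decidable)
  open import Relation.Binary.PropositionalEquality

  module _ {A : Set} {P : Pred A 0ℓ} (P? : Decidable P) where

    count-++ : ∀ xs ys → length (filter P? (xs ++ ys)) ≡ length (filter P? xs) + length (filter P? ys)
    count-++ xs ys = trans (cong length (List.filter-++ P? xs ys)) (List.length-++ (filter P? xs))

    count-all : ∀ {xs} → All P xs → length (filter P? xs) ≡ length xs
    count-all = cong length ∘ List.filter-all P?

    count-replicate : ∀ n {x} → P x → length (filter P? (replicate n x)) ≡ n
    count-replicate n px = trans (count-all (All.replicate⁺ n px)) (List.length-replicate n)

    count-none : ∀ {xs} → All (¬_ ∘ P) xs → length (filter P? xs) ≡ 0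
    count-none = cong length ∘ List.filter-none P?

    count-accept : ∀ {x} xs → P x → length (filter P? (x ∷ xs)) ≡ suc (length (filter P? xs))
    count-accept xs px = cong length (List.filter-accept P? {xs = xs} px)

    count-reject : ∀ {x} xs → ¬ P x → length (filter P? (x ∷ xs)) ≡ length (filter P? xs)
    count-reject xs ¬px = cong length (List.filter-reject P? {xs = xs} ¬px)

    count-∷-≤ : ∀ x xs → length (filter P? (x ∷ xs)) ≤ suc (length (filter P? xs))
    count-∷-≤ x xs with P? x
    ... | yes _ = ℕ.≤-refl
    ... | no _ = ℕ.n≤1+n _

    count-↭ : ∀ {xs ys} → xs ↭ ys → length (filter P? xs) ≡ length (filter P? ys)
    count-↭ = ↭-length ∘ filter-↭ P?

  count-mono : ∀ {A : Set} {P Q : Pred A 0ℓ} (P? : Decidable P) (Q? : Decidable Q) →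
               (∀ {x} → P x → Q x) → ∀ xs → length (filter P? xs) ≤ length (filter Q? xs)
  count-mono P? Q? P⇒Q [] = z≤n
  count-mono P? Q? P⇒Q (x ∷ xs) with P? x | Q? x
  ... | yes _  | yes _  = s≤s (count-mono P? Q? P⇒Q xs)
  ... | yes px | no ¬qx = contradiction (P⇒Q px) ¬qx
  ... | no _   | yes _  = ℕ.m≤n⇒m≤1+n (count-mono P? Q? P⇒Q xs)
  ... | no _   | no _   = count-mono P? Q? P⇒Q xs

  countAtLeast : ℚ → List ℚ → ℕ
  countAtLeast a xs = length (filter (a ≤?_) xs)

  countAbove-anti : ∀ {a b} → a ℚ.≤ b → ∀ xs → countAbove b xs ≤ countAbove a xs
  countAbove-anti a≤b = count-mono (_ <?_) (_ <?_) (ℚ.≤-<-trans a≤b)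

  countAbove≤countAtLeast : ∀ a xs → countAbove a xs ≤ countAtLeast a xs
  countAbove≤countAtLeast a = count-mono (a <?_) (a ≤?_) ℚ.<⇒≤

  countAtLeast≤countAbove : ∀ {a b} → a ℚ.< b → ∀ xs → countAtLeast b xs ≤ countAbove a xs
  countAtLeast≤countAbove a<b = count-mono (_ ≤?_) (_ <?_) (ℚ.<-≤-trans a<b)

  countAtLeast≤length : ∀ a xs → countAtLeast a xs ≤ length xs
  countAtLeast≤length a = List.length-filter (a ≤?_)

  module _ {A : Set} {R : Rel A 0ℓ} where

    Linked-∷ : ∀ {x ys} → All (R x) ys → Linked R ys → Linked R (x ∷ ys)
    Linked-∷ []      _ = [-]
    Linked-∷ (r ∷ _) l = r ∷ l

    Linked-head : Transitive R → ∀ {x ys} → Linked R (x ∷ ys) → All (R x) ys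
    Linked-head _     [-]     = []
    Linked-head R-trans (r ∷ l) = Linked.Linked⇒All R-trans r l

    Linked-replicate-++ : Reflexive R → ∀ n {x ys} → All (R x) ys → Linked R ys →
                          Linked R (replicate n x ++ ys)
    Linked-replicate-++ _    zero    _  l = l
    Linked-replicate-++ R-refl (suc n) rs l =
      Linked-∷ (All.++⁺ (All.replicate⁺ n R-refl) rs) (Linked-replicate-++ R-refl n rs l)

  Descending : List ℚ → Set
  Descending = Linked (λ a b → b ℚ.≤ a)

  descending-head : ∀ {x xs} → Descending (x ∷ xs) → All (ℚ._≤ x) xs
  descending-head = Linked-head (λ y≤x z≤y → ℚ.≤-trans z≤y y≤x)

  insertDesc-↭ : ∀ x ys → insertDesc x ys ↭ x ∷ ys
  insertDesc-↭ x [] = ↭-refl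
  insertDesc-↭ x (y ∷ ys) with y ≤ᵇ x
  ... | true  = ↭-refl
  ... | false = ↭-trans (prep y (insertDesc-↭ x ys)) (swap y x ↭-refl)

  sortDesc-↭ : ∀ xs → sortDesc xs ↭ xs
  sortDesc-↭ [] = ↭-refl
  sortDesc-↭ (x ∷ xs) = ↭-trans (insertDesc-↭ x (sortDesc xs)) (prep x (sortDesc-↭ xs))

  insertDesc-descending : ∀ x {ys} → Descending ys → Descending (insertDesc x ys)
  insertDesc-descending x {[]} _ = [-]
  insertDesc-descending x {y ∷ ys} d with y ≤ᵇ x in y≤ᵇx
  ... | true  = ℚ.≤ᵇ⇒≤ (subst T (sym y≤ᵇx) _) ∷ d
  ... | false = Linked-∷ (All-resp-↭ (↭-sym (insertDesc-↭ x ys)) (x≤y ∷ descending-head d))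
                         (insertDesc-descending x (Linked.tail d))
    where
    x≤y : x ℚ.≤ y
    x≤y = ℚ.<⇒≤ (ℚ.≰⇒> (λ y≤x → subst T y≤ᵇx (ℚ.≤⇒≤ᵇ y≤x)))

  sortDesc-descending : ∀ xs → Descending (sortDesc xs)
  sortDesc-descending [] = []
  sortDesc-descending (x ∷ xs) = insertDesc-descending x (sortDesc-descending xs)

  nthOr0-All : ∀ {P : Pred ℚ 0ℓ} {xs} i → All P xs → i < length xs → P (nthOr0 i xs)
  nthOr0-All zero    (px ∷ _)  _        = px
  nthOr0-All (suc i) (_ ∷ pxs) (s≤s lt) = nthOr0-All i pxs lt

  nthOr0-countAtLeast : ∀ {S} i → Descending S → i < length S → suc i ≤ countAtLeast (nthOr0 i S) S
  nthOr0-countAtLeast {x ∷ xs} zero    d _ =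
    subst (1 ≤_) (sym (count-accept (x ≤?_) xs ℚ.≤-refl)) (s≤s z≤n)
  nthOr0-countAtLeast {x ∷ xs} (suc i) d (s≤s lt) =
    subst (suc (suc i) ≤_) (sym (count-accept (nthOr0 i xs ≤?_) xs (nthOr0-All i (descending-head d) lt)))
      (s≤s (nthOr0-countAtLeast i (Linked.tail d) lt))

  countAbove-nthOr0 : ∀ {S} i → Descending S → i < length S → countAbove (nthOr0 i S) S ≤ i
  countAbove-nthOr0 {x ∷ xs} zero    d _ =
    ℕ.≤-reflexive (count-none (x <?_) (ℚ.<-irrefl refl ∷ All.map ℚ-≤⇒≯ (descending-head d)))
  countAbove-nthOr0 {x ∷ xs} (suc i) d (s≤s lt) =
    ℕ.≤-trans (count-∷-≤ (nthOr0 i xs <?_) x xs) (s≤s (countAbove-nthOr0 i (Linked.tail d) lt))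

  ≤-nthOr0 : ∀ {S a} i → Descending S → suc i ≤ countAtLeast a S → a ℚ.≤ nthOr0 i S
  ≤-nthOr0 {[]} i _ ()
  ≤-nthOr0 {x ∷ xs} {a} zero d le = a≤x (a ≤? x)
    where
    a≤x : Dec (a ℚ.≤ x) → a ℚ.≤ x
    a≤x (yes a≤x) = a≤x
    a≤x (no  a≰x) = contradiction (subst (1 ≤_) (trans (count-reject (a ≤?_) xs a≰x)
      (count-none (a ≤?_) (All.map (λ y≤x a≤y → a≰x (ℚ.≤-trans a≤y y≤x)) (descending-head d)))) le) λ ()
  ≤-nthOr0 {x ∷ xs} {a} (suc i) d le =
    ≤-nthOr0 i (Linked.tail d) (ℕ.≤-pred (ℕ.≤-trans le (count-∷-≤ (a ≤?_) x xs)))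

  module _ (k : ℕ) (cs bs : List ℚ) where

    private
      sorted↭ : sortDesc (bs ++ cs) ↭ bs ++ cs
      sorted↭ = sortDesc-↭ (bs ++ cs)

      sorted-descending : Descending (sortDesc (bs ++ cs))
      sorted-descending = sortDesc-descending (bs ++ cs)

    ≤-price : ∀ {a} → suc k ≤ countAtLeast a (bs ++ cs) → a ℚ.≤ price (suc k) cs bs
    ≤-price {a} le = ≤-nthOr0 k sorted-descending (subst (suc k ≤_) (sym (count-↭ (a ≤?_) sorted↭)) le)

    countAbove-price : suc k ≤ length (bs ++ cs) → countAbove (price (suc k) cs bs) (bs ++ cs) ≤ k
    countAbove-price le = subst (_≤ k) (count-↭ (price (suc k) cs bs <?_) sorted↭)
      (countAbove-nthOr0 k sorted-descending (subst (suc k ≤_) (sym (↭-length sorted↭)) le))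

    price-≡ : ∀ {a} → suc k ≤ countAtLeast a (bs ++ cs) → countAbove a (bs ++ cs) ≤ k →
              price (suc k) cs bs ≡ a
    price-≡ {a} le above = ℚ.≤-antisym price≤a (≤-price le)
      where
      p = price (suc k) cs bs
      k<length : k < length (sortDesc (bs ++ cs))
      k<length = subst (k <_) (sym (↭-length sorted↭)) (ℕ.≤-trans le (countAtLeast≤length a (bs ++ cs)))
      price≤a : p ℚ.≤ a
      price≤a = ℚ.≮⇒≥ λ a<p → contradiction above (ℕ.<⇒≱ (ℕ.≤-trans
        (subst (suc k ≤_) (count-↭ (p ≤?_) sorted↭) (nthOr0-countAtLeast k sorted-descending k<length))
        (countAtLeast≤countAbove a<p (bs ++ cs))))

  module _ {K : ℕ} {cs : List ℚ} where

    winsFrom-accept : ∀ j {b} bs → j + countAbove b cs < K →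
                      winsFrom K cs j (b ∷ bs) ≡ suc (winsFrom K cs (suc j) bs)
    winsFrom-accept j {b} bs lt with j + countAbove b cs <ᵇ K in eq
    ... | true  = refl
    ... | false = contradiction (subst T eq (ℕ.<⇒<ᵇ lt)) λ ()

    winsFrom-reject : ∀ j {b} bs → K ≤ j + countAbove b cs →
                      winsFrom K cs j (b ∷ bs) ≡ winsFrom K cs (suc j) bs
    winsFrom-reject j {b} bs le with j + countAbove b cs <ᵇ K in eq
    ... | true  = contradiction (ℕ.<ᵇ⇒< _ _ (subst T (sym eq) _)) (ℕ.≤⇒≯ le)
    ... | false = refl

    winsFrom-∷-≤ : ∀ j b bs → winsFrom K cs j (b ∷ bs) ≤ suc (winsFrom K cs (suc j) bs)
    winsFrom-∷-≤ j b bs with j + countAbove b cs <ᵇ K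
    ... | true  = ℕ.≤-refl
    ... | false = ℕ.n≤1+n _

    winsFrom-replicate : ∀ j q {b} bs → j + q + countAbove b cs ≤ K →
                         winsFrom K cs j (replicate q b ++ bs) ≡ q + winsFrom K cs (j + q) bs
    winsFrom-replicate j zero    bs _  = cong (λ i → winsFrom K cs i bs) (sym (ℕ.+-identityʳ j))
    winsFrom-replicate j (suc q) {b} bs le = begin
      winsFrom K cs j (b ∷ replicate q b ++ bs)   ≡⟨ winsFrom-accept j (replicate q b ++ bs) j+c<K ⟩
      suc (winsFrom K cs (suc j) (replicate q b ++ bs)) ≡⟨ cong suc (winsFrom-replicate (suc j) q bs le′) ⟩
      suc (q + winsFrom K cs (suc j + q) bs)       ≡⟨ cong (λ i → suc (q + winsFrom K cs i bs)) (sym (ℕ.+-suc j q)) ⟩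
      suc q + winsFrom K cs (j + suc q) bs         ∎
      where
      open ≡-Reasoning
      le′ : suc j + q + countAbove b cs ≤ K
      le′ = subst (λ i → i + countAbove b cs ≤ K) (ℕ.+-suc j q) le
      j+c<K : j + countAbove b cs < K
      j+c<K = ℕ.<-≤-trans (ℕ.+-monoˡ-< (countAbove b cs) (ℕ.m<m+n j (s≤s z≤n))) le

    winsFrom-≤-∸ : ∀ {h} j bs → All (λ b → h ≤ countAbove b cs) bs → winsFrom K cs j bs ≤ K ∸ (j + h)
    winsFrom-≤-∸ j [] _ = z≤n
    winsFrom-≤-∸ {h} j (b ∷ bs) (h≤ ∷ h≤s) with j + countAbove b cs <ᵇ K in eq
    ... | true  = ℕ.≤-trans (s≤s (winsFrom-≤-∸ (suc j) bs h≤s)) (ℕ.≤-reflexive (sym (ℕ.+-∸-assoc 1 j+h<K)))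
      where
      j+h<K : j + h < K
      j+h<K = ℕ.≤-<-trans (ℕ.+-monoʳ-≤ j h≤) (ℕ.<ᵇ⇒< _ _ (subst T (sym eq) _))
    ... | false = ℕ.≤-trans (winsFrom-≤-∸ (suc j) bs h≤s) (ℕ.∸-monoʳ-≤ K (ℕ.n≤1+n (j + h)))

    winsFrom-≤-countAtLeast : ∀ {a} → (∀ b → b ℚ.< a → K ≤ countAbove b cs) →
                              ∀ j bs → winsFrom K cs j bs ≤ countAtLeast a bs
    winsFrom-≤-countAtLeast _ j [] = z≤n
    winsFrom-≤-countAtLeast {a} outbid j (b ∷ bs) with a ≤? b
    ... | yes a≤b = ℕ.≤-trans (winsFrom-∷-≤ j b bs)
          (subst (suc (winsFrom K cs (suc j) bs) ≤_) (sym (count-accept (a ≤?_) bs a≤b))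
            (s≤s (winsFrom-≤-countAtLeast outbid (suc j) bs)))
    ... | no  a≰b = subst₂ _≤_ (sym (winsFrom-reject j bs (ℕ.≤-trans (outbid b (ℚ.≰⇒> a≰b)) (ℕ.m≤n+m _ j))))
          (sym (count-reject (a ≤?_) bs a≰b)) (winsFrom-≤-countAtLeast outbid (suc j) bs)

    ≤-winsFrom : ∀ {a} j {bs} n → Descending bs → n ≤ countAtLeast a bs → j + n + countAbove a cs ≤ K →
                 n ≤ winsFrom K cs j bs
    ≤-winsFrom j zero _ _ _ = z≤n
    ≤-winsFrom j {[]} (suc n) _ () _
    ≤-winsFrom {a} j {b ∷ bs} (suc n) d le fits with a ≤? b
    ... | yes a≤b = subst (suc n ≤_) (sym (winsFrom-accept j bs j+c<K))
          (s≤s (≤-winsFrom (suc j) n (Linked.tail d) n≤ (subst (λ i → i + countAbove a cs ≤ K) (ℕ.+-suc j n) fits)))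
      where
      n≤ : n ≤ countAtLeast a bs
      n≤ = ℕ.≤-pred (subst (suc n ≤_) (count-accept (a ≤?_) bs a≤b) le)
      j+c<K : j + countAbove b cs < K
      j+c<K = ℕ.≤-<-trans (ℕ.+-monoʳ-≤ j (countAbove-anti a≤b cs))
                (ℕ.<-≤-trans (ℕ.+-monoˡ-< (countAbove a cs) (ℕ.m<m+n j (s≤s z≤n))) fits)
    ... | no  a≰b = contradiction (subst (suc n ≤_) (trans (count-reject (a ≤?_) bs a≰b)
                      (count-none (a ≤?_) (All.map (λ c≤b a≤c → a≰b (ℚ.≤-trans a≤c c≤b)) (descending-head d)))) le) λ ()

  StrictlyDecreasing : Strategy → Set
  StrictlyDecreasing = Linked (λ p p′ → proj₁ p′ ℚ.< proj₁ p)

  strictlyDecreasing-head : ∀ {b q s} → StrictlyDecreasing ((b , q) ∷ s) → All (λ p → proj₁ p ℚ.< b) s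
  strictlyDecreasing-head = Linked-head (λ r r′ → ℚ.<-trans r′ r)

  bidVector-All : ∀ {P : Pred ℚ 0ℓ} {s} → All (P ∘ proj₁) s → All P (bidVector s)
  bidVector-All [] = []
  bidVector-All {s = (b , q) ∷ s} (pb ∷ ps) = All.++⁺ (All.replicate⁺ q pb) (bidVector-All ps)

  bidVector-descending : ∀ {s} → StrictlyDecreasing s → Descending (bidVector s)
  bidVector-descending {[]} _ = []
  bidVector-descending {(b , q) ∷ s} d = Linked-replicate-++ ℚ.≤-refl q
    (bidVector-All (All.map ℚ.<⇒≤ (strictlyDecreasing-head d))) (bidVector-descending (Linked.tail d))

  countAtLeast-replicate-++ : ∀ a {b} q rest → a ℚ.≤ b →
                              countAtLeast a (replicate q b ++ rest) ≡ q + countAtLeast a rest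
  countAtLeast-replicate-++ a q rest a≤b =
    trans (count-++ (a ≤?_) (replicate q _) rest) (cong (_+ countAtLeast a rest) (count-replicate (a ≤?_) q a≤b))

  bidVector-++ : ∀ s t → bidVector (s ++ t) ≡ bidVector s ++ bidVector t
  bidVector-++ []            t = refl
  bidVector-++ ((b , q) ∷ s) t =
    trans (cong (replicate q b ++_) (bidVector-++ s t)) (sym (List.++-assoc (replicate q b) _ _))

  length-bidVector : ∀ s → length (bidVector s) ≡ totalQ s
  length-bidVector []            = refl
  length-bidVector ((b , q) ∷ s) =
    trans (List.length-++ (replicate q b)) (cong₂ _+_ (List.length-replicate q) (length-bidVector s))

  -- Rounds against h high rival bids and K rival bids at a

  rivals : ℕ → ℚ → ℕ → ℚ → List ℚ
  rivals h hi K a = replicate h hi ++ replicate K a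

  countAbove-rivals : ∀ h {hi} K {a} → a ℚ.< hi → countAbove a (rivals h hi K a) ≡ h
  countAbove-rivals h K {a} a<hi = begin
    countAbove a (rivals h _ K a)                                   ≡⟨ count-++ (a <?_) (replicate h _) (replicate K a) ⟩
    countAbove a (replicate h _) + countAbove a (replicate K a)     ≡⟨ cong₂ _+_ (count-replicate (a <?_) h a<hi)
                                                                         (count-none (a <?_) (All.replicate⁺ K (ℚ.<-irrefl refl))) ⟩
    h + 0                                                           ≡⟨ ℕ.+-identityʳ h ⟩
    h                                                               ∎
    where open ≡-Reasoning

  rivals-outbid : ∀ h hi K {a b} → b ℚ.< a → K ≤ countAbove b (rivals h hi K a)
  rivals-outbid h hi K {a} {b} b<a = begin
    K                                                           ≡⟨ count-replicate (b <?_) K b<a ⟨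
    countAbove b (replicate K a)                                ≤⟨ ℕ.m≤n+m _ _ ⟩
    countAbove b (replicate h hi) + countAbove b (replicate K a) ≡⟨ count-++ (b <?_) (replicate h hi) (replicate K a) ⟨
    countAbove b (rivals h hi K a)                              ∎
    where open ℕ.≤-Reasoning

  rivals-high : ∀ h {hi} K a {b} → b ℚ.< hi → h ≤ countAbove b (rivals h hi K a)
  rivals-high h {hi} K a {b} b<hi = begin
    h                                                           ≡⟨ count-replicate (b <?_) h b<hi ⟨
    countAbove b (replicate h hi)                               ≤⟨ ℕ.m≤m+n _ _ ⟩
    countAbove b (replicate h hi) + countAbove b (replicate K a) ≡⟨ count-++ (b <?_) (replicate h hi) (replicate K a) ⟨
    countAbove b (rivals h hi K a)                              ∎
    where open ℕ.≤-Reasoning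

  units-rivals-≤ : ∀ h hi K a bs → units K (rivals h hi K a) bs ≤ countAtLeast a bs
  units-rivals-≤ h hi K a = winsFrom-≤-countAtLeast (λ b → rivals-outbid h hi K) 0

  rivals-round : ∀ {k h hi a x bs} → Descending bs → All (ℚ._< hi) bs → a ℚ.< hi →
                 x ≤ countAtLeast a bs → x + h ≤ suc k → countAbove a bs + h ≤ k →
                 countAtLeast a bs ≤ x ⊎ suc k ≤ x + h →
                 units (suc k) (rivals h hi (suc k) a) bs ≡ x × price (suc k) (rivals h hi (suc k) a) bs ≡ a
  rivals-round {k} {h} {hi} {a} {x} {bs} desc bs<hi a<hi x≤ fits above≤ cut =
    ℕ.≤-antisym (won≤ cut) x≤won , price-≡ k cs bs K≤ above≤′
    where
    cs = rivals h hi (suc k) a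
    x≤won : x ≤ units (suc k) cs bs
    x≤won = ≤-winsFrom 0 x desc x≤ (subst (λ n → x + n ≤ suc k) (sym (countAbove-rivals h (suc k) a<hi)) fits)
    won≤ : countAtLeast a bs ≤ x ⊎ suc k ≤ x + h → units (suc k) cs bs ≤ x
    won≤ (inj₁ cut≤x) = ℕ.≤-trans (units-rivals-≤ h hi (suc k) a bs) cut≤x
    won≤ (inj₂ K≤x+h) = ℕ.≤-trans (winsFrom-≤-∸ 0 bs (All.map (rivals-high h (suc k) a) bs<hi))
                          (subst (suc k ∸ h ≤_) (ℕ.m+n∸n≡m x h) (ℕ.∸-monoˡ-≤ h K≤x+h))
    K≤ : suc k ≤ countAtLeast a (bs ++ cs)
    K≤ = begin
      suc k                                    ≡⟨ count-replicate (a ≤?_) (suc k) ℚ.≤-refl ⟨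
      countAtLeast a (replicate (suc k) a)     ≤⟨ ℕ.m≤n+m _ _ ⟩
      countAtLeast a (bs ++ replicate h hi) + countAtLeast a (replicate (suc k) a)
                                               ≡⟨ count-++ (a ≤?_) (bs ++ replicate h hi) _ ⟨
      countAtLeast a ((bs ++ replicate h hi) ++ replicate (suc k) a) ≡⟨ cong (countAtLeast a) (List.++-assoc bs _ _) ⟩
      countAtLeast a (bs ++ cs)                ∎
      where open ℕ.≤-Reasoning
    above≤′ : countAbove a (bs ++ cs) ≤ k
    above≤′ = subst (_≤ k) (sym (trans (count-++ (a <?_) bs cs) (cong (countAbove a bs +_) (countAbove-rivals h (suc k) a<hi))))
                above≤

module UpperBound where

  open import Defs
  open Rationals
  open Auctions
  open import Data.Nat.Base using (ℕ; zero; suc; z≤n; s≤s; _+_; _∸_; _≤_; _<_)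
  import Data.Nat.Properties as ℕ
  open import Data.Rational.Base as ℚ using (ℚ; 0ℚ)
  import Data.Rational.Properties as ℚ
  open import Data.Rational.Properties using (_<?_; _≤?_)
  open import Data.List.Base using (List; []; _∷_; _++_; length; map; take; replicate; foldr)
  import Data.List.Properties as List
  open import Data.List.Relation.Unary.All as All using (All; []; _∷_)
  import Data.List.Relation.Unary.All.Properties as All
  open import Data.List.Relation.Unary.Any using (Any; here; there)
  open import Data.List.Relation.Unary.Linked using (Linked; []; [-]; _∷_)
  import Data.List.Relation.Unary.Linked as Linked
  import Data.List.Relation.Unary.Linked.Properties as Linked
  open import Data.List.Membership.Propositional using (_∈_; find; lose)
  open import Data.List.Membership.Propositional.Properties using (∈-map⁺)
  open import Data.List.Relation.Binary.Sublist.Propositional as Sublist using (_⊆_; []; _∷_; _∷ʳ_; ⊆-refl; ⊆-trans)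
  open import Data.List.Relation.Binary.Sublist.Propositional.Properties using (All-resp-⊆; length-mono-≤)
  open import Data.Product.Base using (_×_; _,_; proj₁; proj₂; uncurry; ∃-syntax)
  open import Data.Sum.Base using (_⊎_; inj₁; inj₂)
  open import Data.Unit.Base using (tt)
  open import Relation.Nullary using (¬_; Dec; yes; no)
  open import Relation.Nullary.Decidable using (_×-dec_)
  open import Relation.Nullary.Negation using (contradiction)
  open import Relation.Binary.PropositionalEquality

  -- Strategies in P̄ with prescribed quantities

  module _ (v : List ℚ) where

    cutoff : ℚ → ℕ → ℕ
    cutoff b zero = zero
    cutoff b (suc y) with b ≤? avg v (suc y)
    ... | yes _ = suc y
    ... | no  _ = cutoff b y

    cutoff-≤ : ∀ b Q → cutoff b Q ≤ Q
    cutoff-≤ b zero = z≤n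
    cutoff-≤ b (suc y) with b ≤? avg v (suc y)
    ... | yes _ = ℕ.≤-refl
    ... | no  _ = ℕ.m≤n⇒m≤1+n (cutoff-≤ b y)

    ≤-avg-cutoff : ∀ b Q → 1 ≤ cutoff b Q → b ℚ.≤ avg v (cutoff b Q)
    ≤-avg-cutoff b (suc y) pos with b ≤? avg v (suc y)
    ... | yes b≤ = b≤
    ... | no  _  = ≤-avg-cutoff b y pos

    cutoff-maximal : ∀ b Q {x} → 1 ≤ x → x ≤ Q → b ℚ.≤ avg v x → x ≤ cutoff b Q
    cutoff-maximal b zero 1≤x x≤0 _ = contradiction (ℕ.≤-trans 1≤x x≤0) λ ()
    cutoff-maximal b (suc y) 1≤x x≤Q b≤ with b ≤? avg v (suc y)
    ... | yes _ = x≤Q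
    ... | no b≰ with ℕ.m≤n⇒m<n∨m≡n x≤Q
    ...   | inj₁ (s≤s x≤y) = cutoff-maximal b y 1≤x x≤y b≤
    ...   | inj₂ refl      = contradiction b≤ b≰

    cutoff-mono : ∀ {b b′ Q Q′} → b′ ℚ.≤ b → Q ≤ Q′ → cutoff b Q ≤ cutoff b′ Q′
    cutoff-mono {b} {b′} {Q} {Q′} b′≤b Q≤Q′ with cutoff b Q | cutoff-≤ b Q | ≤-avg-cutoff b Q
    ... | zero  | _   | _    = z≤n
    ... | suc y | y≤Q | b≤ = cutoff-maximal b′ Q′ (s≤s z≤n) (ℕ.≤-trans y≤Q Q≤Q′) (ℚ.≤-trans b′≤b (b≤ (s≤s z≤n)))

    AvgDecreasing : List ℕ → Set
    AvgDecreasing = Linked (λ y z → avg v z ℚ.< avg v y)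

    push : ℕ → List ℕ → List ℕ
    push zero    zs       = zs
    push (suc y) []       = suc y ∷ []
    push (suc y) (z ∷ zs) with suc y ℕ.<? z ×-dec avg v z <? avg v (suc y)
    ... | yes _ = suc y ∷ z ∷ zs
    ... | no  _ = z ∷ zs

    prune : List ℕ → List ℕ
    prune = foldr push []

    push-⊆ : ∀ y zs → push y zs ⊆ y ∷ zs
    push-⊆ zero    zs       = zero ∷ʳ ⊆-refl
    push-⊆ (suc y) []       = ⊆-refl
    push-⊆ (suc y) (z ∷ zs) with suc y ℕ.<? z ×-dec avg v z <? avg v (suc y)
    ... | yes _ = ⊆-refl
    ... | no  _ = suc y ∷ʳ ⊆-refl

    push-⊇ : ∀ y zs → zs ⊆ push y zs
    push-⊇ zero    zs       = ⊆-refl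
    push-⊇ (suc y) []       = suc y ∷ʳ []
    push-⊇ (suc y) (z ∷ zs) with suc y ℕ.<? z ×-dec avg v z <? avg v (suc y)
    ... | yes _ = suc y ∷ʳ ⊆-refl
    ... | no  _ = ⊆-refl

    push-increasing : ∀ y {zs} → Linked _<_ (0 ∷ zs) → Linked _<_ (0 ∷ push y zs)
    push-increasing zero    inc = inc
    push-increasing (suc y) {[]} _ = s≤s z≤n ∷ [-]
    push-increasing (suc y) {z ∷ zs} inc with suc y ℕ.<? z ×-dec avg v z <? avg v (suc y)
    ... | yes (y<z , _) = s≤s z≤n ∷ y<z ∷ Linked.tail inc
    ... | no  _         = inc

    push-avgDecreasing : ∀ y {zs} → AvgDecreasing zs → AvgDecreasing (push y zs)
    push-avgDecreasing zero    dec = dec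
    push-avgDecreasing (suc y) {[]} _ = [-]
    push-avgDecreasing (suc y) {z ∷ zs} dec with suc y ℕ.<? z ×-dec avg v z <? avg v (suc y)
    ... | yes (_ , w<) = w< ∷ dec
    ... | no  _        = dec

    prune-⊆ : ∀ ys → prune ys ⊆ ys
    prune-⊆ []       = []
    prune-⊆ (y ∷ ys) = ⊆-trans (push-⊆ y (prune ys)) (refl ∷ prune-⊆ ys)

    prune-increasing : ∀ ys → Linked _<_ (0 ∷ prune ys)
    prune-increasing []       = [-]
    prune-increasing (y ∷ ys) = push-increasing y (prune-increasing ys)

    prune-avgDecreasing : ∀ ys → AvgDecreasing (prune ys)
    prune-avgDecreasing []       = []
    prune-avgDecreasing (y ∷ ys) = push-avgDecreasing y (prune-avgDecreasing ys)

    Dominated : ℕ → List ℕ → Set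
    Dominated y = Any (λ z → y ≤ z × avg v y ℚ.≤ avg v z)

    push-dominates : ∀ y {zs} → All (suc y ≤_) zs → Dominated (suc y) (push (suc y) zs)
    push-dominates y {[]} _ = here (ℕ.≤-refl , ℚ.≤-refl)
    push-dominates y {z ∷ zs} (y<z ∷ _) with suc y ℕ.<? z ×-dec avg v z <? avg v (suc y)
    ... | yes _      = here (ℕ.≤-refl , ℚ.≤-refl)
    ... | no  ¬both  = here (y<z , avg≤ (suc y ℕ.<? z))
      where
      avg≤ : Dec (suc y < z) → avg v (suc y) ℚ.≤ avg v z
      avg≤ (yes lt) = ℚ.≮⇒≥ (λ w< → ¬both (lt , w<))
      avg≤ (no ¬lt) = ℚ.≤-reflexive (cong (avg v) (ℕ.≤∧≮⇒≡ y<z ¬lt))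

    prune-dominates : ∀ {ys} → Linked _≤_ ys → ∀ {y} → y ∈ ys → 1 ≤ y → Dominated y (prune ys)
    prune-dominates {zero  ∷ ys} sorted (here refl) ()
    prune-dominates {suc y ∷ ys} sorted (here refl) _ =
      push-dominates y (All-resp-⊆ (prune-⊆ ys) (Linked-head ℕ.≤-trans sorted))
    prune-dominates {y′ ∷ ys} sorted (there y∈) pos =
      Sublist.lookup (push-⊇ y′ (prune ys)) (prune-dominates (Linked.tail sorted) y∈ pos)

    levelsFrom : ℕ → List ℕ → Strategy
    levelsFrom acc []       = []
    levelsFrom acc (z ∷ zs) = (avg v z , z ∸ acc) ∷ levelsFrom z zs

    levelsFrom-length : ∀ acc zs → length (levelsFrom acc zs) ≡ length zs
    levelsFrom-length acc []       = refl
    levelsFrom-length acc (z ∷ zs) = cong suc (levelsFrom-length z zs)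

    levelsFrom-strictlyDecreasing : ∀ acc {zs} → AvgDecreasing zs → StrictlyDecreasing (levelsFrom acc zs)
    levelsFrom-strictlyDecreasing acc []         = []
    levelsFrom-strictlyDecreasing acc [-]        = [-]
    levelsFrom-strictlyDecreasing acc {z ∷ _} (w< ∷ dec) = w< ∷ levelsFrom-strictlyDecreasing z dec

    levelsFrom-bidsPos : Valuation v → ∀ {acc zs} → Linked _<_ (acc ∷ zs) →
                         All (λ p → 0ℚ ℚ.< proj₁ p) (levelsFrom acc zs)
    levelsFrom-bidsPos val {zs = []} _ = []
    levelsFrom-bidsPos val {zs = suc z ∷ zs} (_ ∷ inc) = avg-pos val z ∷ levelsFrom-bidsPos val inc

    levelsFrom-qtyPos : ∀ {acc zs} → Linked _<_ (acc ∷ zs) → All (λ p → 1 ≤ proj₂ p) (levelsFrom acc zs)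
    levelsFrom-qtyPos {zs = []} _ = []
    levelsFrom-qtyPos {acc} {z ∷ zs} (acc<z ∷ inc) = ℕ.m<n⇒0<n∸m acc<z ∷ levelsFrom-qtyPos inc

    levelsFrom-totalQ : ∀ {acc zs M} → Linked _<_ (acc ∷ zs) → All (_≤ M) (acc ∷ zs) →
                        acc + totalQ (levelsFrom acc zs) ≤ M
    levelsFrom-totalQ {acc} {[]} _ (acc≤M ∷ _) = ℕ.≤-trans (ℕ.≤-reflexive (ℕ.+-identityʳ acc)) acc≤M
    levelsFrom-totalQ {acc} {z ∷ zs} (acc<z ∷ inc) (_ ∷ bounded) = begin
      acc + (z ∸ acc + totalQ (levelsFrom z zs)) ≡⟨ ℕ.+-assoc acc (z ∸ acc) _ ⟨
      acc + (z ∸ acc) + totalQ (levelsFrom z zs) ≡⟨ cong (_+ totalQ (levelsFrom z zs)) (ℕ.m+[n∸m]≡n (ℕ.<⇒≤ acc<z)) ⟩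
      z + totalQ (levelsFrom z zs)               ≤⟨ levelsFrom-totalQ inc bounded ⟩
      _                                          ∎
      where open ℕ.≤-Reasoning

    levelsFrom-avgs : ∀ {acc zs} → Linked _<_ (acc ∷ zs) → BidsAreAvgs v acc (levelsFrom acc zs)
    levelsFrom-avgs {zs = []} _ = tt
    levelsFrom-avgs {acc} {z ∷ zs} (acc<z ∷ inc) =
      cong (avg v) (sym end≡z) , subst (λ a → BidsAreAvgs v a (levelsFrom z zs)) (sym end≡z) (levelsFrom-avgs inc)
      where
      end≡z : acc + (z ∸ acc) ≡ z
      end≡z = ℕ.m+[n∸m]≡n (ℕ.<⇒≤ acc<z)

    levelsFrom-countAtLeast : ∀ {acc zs} → Linked _<_ (acc ∷ zs) → AvgDecreasing zs →
                              ∀ {z} → z ∈ zs → z ≤ acc + countAtLeast (avg v z) (bidVector (levelsFrom acc zs))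
    levelsFrom-countAtLeast {acc} {z ∷ zs} (acc<z ∷ _) _ (here refl) = begin
      z                                                   ≡⟨ ℕ.m+[n∸m]≡n (ℕ.<⇒≤ acc<z) ⟨
      acc + (z ∸ acc)                                     ≤⟨ ℕ.+-monoʳ-≤ acc (ℕ.m≤m+n (z ∸ acc) _) ⟩
      acc + (z ∸ acc + countAtLeast (avg v z) rest)       ≡⟨ cong (acc +_) (countAtLeast-replicate-++ (avg v z) (z ∸ acc) rest ℚ.≤-refl) ⟨
      acc + countAtLeast (avg v z) (bidVector (levelsFrom acc (z ∷ zs))) ∎
      where
      open ℕ.≤-Reasoning
      rest = bidVector (levelsFrom z zs)
    levelsFrom-countAtLeast {acc} {z′ ∷ zs} (acc<z′ ∷ inc) dec {z} (there z∈) = begin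
      z                                                   ≤⟨ levelsFrom-countAtLeast inc (Linked.tail dec) z∈ ⟩
      z′ + countAtLeast (avg v z) rest                    ≡⟨ cong (_+ countAtLeast (avg v z) rest) (ℕ.m+[n∸m]≡n (ℕ.<⇒≤ acc<z′)) ⟨
      acc + (z′ ∸ acc) + countAtLeast (avg v z) rest      ≡⟨ ℕ.+-assoc acc (z′ ∸ acc) _ ⟩
      acc + (z′ ∸ acc + countAtLeast (avg v z) rest)      ≡⟨ cong (acc +_) (countAtLeast-replicate-++ (avg v z) (z′ ∸ acc) rest avg≤) ⟨
      acc + countAtLeast (avg v z) (bidVector (levelsFrom acc (z′ ∷ zs))) ∎
      where
      open ℕ.≤-Reasoning
      rest = bidVector (levelsFrom z′ zs)
      avg≤ : avg v z ℚ.≤ avg v z′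
      avg≤ = ℚ.<⇒≤ (All.lookup (Linked-head (λ r r′ → ℚ.<-trans r′ r) dec) z∈)

    -- Any strategy in P̄ does for the empty chain.
    fromChain : List ℕ → Strategy
    fromChain []           = (avg v 1 , 1) ∷ []
    fromChain zs@(_ ∷ _)   = levelsFrom 0 zs

    pbarOf : List ℕ → Strategy
    pbarOf ys = fromChain (prune ys)

    fromChain-InPbar : Valuation v → ∀ {m zs} → 1 ≤ m → Linked _<_ (0 ∷ zs) → AvgDecreasing zs →
                       All (_≤ length v) zs → length zs ≤ m → InPbar m v (fromChain zs)
    fromChain-InPbar val {zs = []} 1≤m _ _ _ _ =
      record { kpos = s≤s z≤n ; k≤m = 1≤m ; strictDec = [-] ; bidsPos = avg-pos val 0 ∷ []
             ; qtyPos = s≤s z≤n ∷ [] ; Q≤M = Valuation.nonempty val } , refl , tt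
    fromChain-InPbar val {m} {zs@(_ ∷ _)} _ inc dec bounded len =
      record { kpos = s≤s z≤n ; k≤m = subst (_≤ m) (sym (levelsFrom-length 0 zs)) len
             ; strictDec = levelsFrom-strictlyDecreasing 0 dec ; bidsPos = levelsFrom-bidsPos val inc
             ; qtyPos = levelsFrom-qtyPos inc ; Q≤M = levelsFrom-totalQ inc (z≤n ∷ bounded) } ,
      levelsFrom-avgs inc

    pbarOf-InPbar : Valuation v → ∀ {m ys} → 1 ≤ m → All (_≤ length v) ys → length ys ≤ m → InPbar m v (pbarOf ys)
    pbarOf-InPbar val {ys = ys} 1≤m bounded len =
      fromChain-InPbar val 1≤m (prune-increasing ys) (prune-avgDecreasing ys)
        (All-resp-⊆ (prune-⊆ ys) bounded) (ℕ.≤-trans (length-mono-≤ (prune-⊆ ys)) len)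

    pbarOf-descending : ∀ ys → Descending (bidVector (pbarOf ys))
    pbarOf-descending ys with prune ys | prune-avgDecreasing ys
    ... | []       | _   = [-]
    ... | zs@(_ ∷ _) | dec = bidVector-descending (levelsFrom-strictlyDecreasing 0 dec)

    pbarOf-countAtLeast : ∀ ys {z} → z ∈ prune ys → z ≤ countAtLeast (avg v z) (bidVector (pbarOf ys))
    pbarOf-countAtLeast ys z∈ with prune ys | prune-increasing ys | prune-avgDecreasing ys
    ... | _ ∷ _ | inc | dec = levelsFrom-countAtLeast inc dec z∈

    -- Bidding avg v y on y units against cs would win at least x of the K units.
    Reaches : ℕ → List ℚ → ℕ → ℕ → Set
    Reaches K cs x y = x ≤ y × x + countAbove (avg v y) cs ≤ K

    pbarOf-wins : ∀ {K cs x ys} → Linked _≤_ ys → 1 ≤ x → Any (Reaches K cs x) ys →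
                  x ≤ units K cs (bidVector (pbarOf ys))
    pbarOf-wins {K} {cs} {x} {ys} sorted 1≤x reach with find reach
    ... | y , y∈ , x≤y , fits with find (prune-dominates sorted y∈ (ℕ.≤-trans 1≤x x≤y))
    ...   | z , z∈ , y≤z , avg≤ =
      ≤-winsFrom 0 x (pbarOf-descending ys) (ℕ.≤-trans x≤y (ℕ.≤-trans y≤z (pbarOf-countAtLeast ys z∈)))
        (ℕ.≤-trans (ℕ.+-monoʳ-≤ x (countAbove-anti avg≤ cs)) fits)

  -- The block of bids holding the last winning unit

  cumulative : ℕ → Strategy → List (ℚ × ℕ)
  cumulative acc []             = []
  cumulative acc ((b , q) ∷ s)  = (b , acc + q) ∷ cumulative (acc + q) s

  cumulative-length : ∀ acc s → length (cumulative acc s) ≡ length s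
  cumulative-length acc []            = refl
  cumulative-length acc ((b , q) ∷ s) = cong suc (cumulative-length (acc + q) s)

  cumulative-bids : ∀ {P : ℚ → Set} acc {s} → All (λ p → P (proj₁ p)) s → All (λ p → P (proj₁ p)) (cumulative acc s)
  cumulative-bids acc [] = []
  cumulative-bids acc {(b , q) ∷ s} (pb ∷ ps) = pb ∷ cumulative-bids (acc + q) ps

  cumulative-≤ : ∀ acc s → All (λ p → proj₂ p ≤ acc + totalQ s) (cumulative acc s)
  cumulative-≤ acc []            = []
  cumulative-≤ acc ((b , q) ∷ s) = ℕ.+-monoʳ-≤ acc (ℕ.m≤m+n q (totalQ s))
    ∷ All.map (λ le → ℕ.≤-trans le (ℕ.≤-reflexive (ℕ.+-assoc acc q (totalQ s)))) (cumulative-≤ (acc + q) s)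

  cumulative-sorted : ∀ acc {s} → StrictlyDecreasing s →
                      Linked (λ p p′ → proj₁ p′ ℚ.< proj₁ p × proj₂ p ≤ proj₂ p′) (cumulative acc s)
  cumulative-sorted acc []  = []
  cumulative-sorted acc [-] = [-]
  cumulative-sorted acc {(b , q) ∷ (b′ , q′) ∷ s} (b′<b ∷ sd) =
    (b′<b , ℕ.m≤m+n (acc + q) q′) ∷ cumulative-sorted (acc + q) sd

  cumulative-countAtLeast : ∀ acc {s} → StrictlyDecreasing s → ∀ {b Q} → (b , Q) ∈ cumulative acc s →
                            Q ≤ acc + countAtLeast b (bidVector s)
  cumulative-countAtLeast acc {(b , q) ∷ s} _ (here refl) = ℕ.+-monoʳ-≤ acc
    (subst (q ≤_) (sym (countAtLeast-replicate-++ b q (bidVector s) ℚ.≤-refl)) (ℕ.m≤m+n q _))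
  cumulative-countAtLeast acc {(b′ , q) ∷ s} sd {b} {Q} (there bQ∈) = begin
    Q                                          ≤⟨ cumulative-countAtLeast (acc + q) (Linked.tail sd) bQ∈ ⟩
    acc + q + countAtLeast b (bidVector s)     ≡⟨ ℕ.+-assoc acc q _ ⟩
    acc + (q + countAtLeast b (bidVector s))   ≡⟨ cong (acc +_) (countAtLeast-replicate-++ b q (bidVector s) b≤b′) ⟨
    acc + countAtLeast b (bidVector ((b′ , q) ∷ s)) ∎
    where
    open ℕ.≤-Reasoning
    b≤b′ : b ℚ.≤ b′
    b≤b′ = ℚ.<⇒≤ (All.lookup (cumulative-bids (acc + q) (strictlyDecreasing-head sd)) bQ∈)

  +-≤-of-≤-∸ : ∀ {a x c K} → a < x → x ≤ a + (K ∸ (a + c)) → x + c ≤ K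
  +-≤-of-≤-∸ {a} {x} {c} {K} a<x x≤ with a + c ℕ.≤? K
  ... | yes a+c≤K = begin
    x + c                  ≤⟨ ℕ.+-monoˡ-≤ c x≤ ⟩
    a + (K ∸ (a + c)) + c  ≡⟨ ℕ.+-assoc a _ c ⟩
    a + (K ∸ (a + c) + c)  ≡⟨ cong (a +_) (ℕ.+-comm _ c) ⟩
    a + (c + (K ∸ (a + c))) ≡⟨ ℕ.+-assoc a c _ ⟨
    a + c + (K ∸ (a + c))  ≡⟨ ℕ.m+[n∸m]≡n a+c≤K ⟩
    K                      ∎
    where open ℕ.≤-Reasoning
  ... | no  a+c≰K = contradiction (ℕ.<-≤-trans a<x x≤)
    (subst (λ n → ¬ a < a + n) (sym (ℕ.m≤n⇒m∸n≡0 (ℕ.<⇒≤ (ℕ.≰⇒> a+c≰K))))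
      (λ a<a+0 → ℕ.<-irrefl (sym (ℕ.+-identityʳ a)) a<a+0))

  -- The block of bid b ending at quantity Q holds the x-th unit won: either it is won in
  -- full, or it is rationed, and then b is among the K highest bids.
  record WinningBlock (K : ℕ) (cs : List ℚ) (x : ℕ) (b : ℚ) (Q : ℕ) : Set where
    field
      x≤Q   : x ≤ Q
      fits  : x + countAbove b cs ≤ K
      whole : x ≡ Q ⊎ K ≤ Q + countAbove b cs

  winning-block : ∀ {K cs} acc s → StrictlyDecreasing s → ∀ {x} → x ≡ acc + winsFrom K cs acc (bidVector s) →
                  acc < x → Any (uncurry (WinningBlock K cs x)) (cumulative acc s)
  winning-block acc [] _ refl acc<x = contradiction acc<x (ℕ.<-irrefl (sym (ℕ.+-identityʳ acc)))
  winning-block {K} {cs} acc ((b , q) ∷ s) sd {x} x≡ acc<x with acc + q + countAbove b cs ℕ.≤? K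
  ... | yes fits = wonInside (acc + q ℕ.<? x)
    where
    x≡′ : x ≡ acc + q + winsFrom K cs (acc + q) (bidVector s)
    x≡′ = trans x≡ (trans (cong (acc +_) (winsFrom-replicate acc q (bidVector s) fits)) (sym (ℕ.+-assoc acc q _)))
    wonInside : Dec (acc + q < x) → Any (uncurry (WinningBlock K cs x)) (cumulative acc ((b , q) ∷ s))
    wonInside (yes Q<x) = there (winning-block (acc + q) s (Linked.tail sd) x≡′ Q<x)
    wonInside (no  Q≮x) = here record
      { x≤Q   = ℕ.≮⇒≥ Q≮x
      ; fits  = ℕ.≤-trans (ℕ.+-monoˡ-≤ (countAbove b cs) (ℕ.≮⇒≥ Q≮x)) fits
      ; whole = inj₁ (ℕ.≤-antisym (ℕ.≮⇒≥ Q≮x) (subst (acc + q ≤_) (sym x≡′) (ℕ.m≤m+n (acc + q) _)))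
      }
  ... | no ¬fits = here record
    { x≤Q   = ℕ.+-cancelʳ-≤ (countAbove b cs) x (acc + q) (ℕ.≤-trans x+c≤K K≤)
    ; fits  = x+c≤K
    ; whole = inj₂ K≤
    }
    where
    K≤ : K ≤ acc + q + countAbove b cs
    K≤ = ℕ.<⇒≤ (ℕ.≰⇒> ¬fits)
    bids≤b : All (ℚ._≤ b) (bidVector ((b , q) ∷ s))
    bids≤b = bidVector-All (ℚ.≤-refl ∷ All.map ℚ.<⇒≤ (strictlyDecreasing-head sd))
    x+c≤K : x + countAbove b cs ≤ K
    x+c≤K = +-≤-of-≤-∸ acc<x (subst (_≤ _) (sym x≡)
              (ℕ.+-monoʳ-≤ acc (winsFrom-≤-∸ acc _ (All.map (λ b′≤b → countAbove-anti b′≤b cs) bids≤b))))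

  -- Two strategies in P̄ matching an RoI-feasible strategy

  blockEnds : Strategy → List ℕ
  blockEnds s = map proj₂ (cumulative 0 s)

  blockCutoffs : List ℚ → Strategy → List ℕ
  blockCutoffs v s = map (uncurry (cutoff v)) (cumulative 0 s)

  blockEnds-sorted : ∀ {s} → StrictlyDecreasing s → Linked _≤_ (blockEnds s)
  blockEnds-sorted sd = Linked.map⁺ (Linked.map proj₂ (cumulative-sorted 0 sd))

  blockCutoffs-sorted : ∀ v {s} → StrictlyDecreasing s → Linked _≤_ (blockCutoffs v s)
  blockCutoffs-sorted v sd =
    Linked.map⁺ (Linked.map (λ (b′<b , Q≤Q′) → cutoff-mono v (ℚ.<⇒≤ b′<b) Q≤Q′) (cumulative-sorted 0 sd))

  blockEnds-InPbar : ∀ {m v s} → Valuation v → 1 ≤ m → IsUniform m v s → InPbar m v (pbarOf v (blockEnds s))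
  blockEnds-InPbar {s = s} val 1≤m uniform = pbarOf-InPbar _ val 1≤m
    (All.map⁺ (All.map (λ Q≤ → ℕ.≤-trans Q≤ (IsUniform.Q≤M uniform)) (cumulative-≤ 0 s)))
    (subst (_≤ _) (sym (trans (List.length-map proj₂ (cumulative 0 s)) (cumulative-length 0 s))) (IsUniform.k≤m uniform))

  blockCutoffs-InPbar : ∀ {m v s} → Valuation v → 1 ≤ m → IsUniform m v s → InPbar m v (pbarOf v (blockCutoffs v s))
  blockCutoffs-InPbar {v = v} {s} val 1≤m uniform = pbarOf-InPbar _ val 1≤m
    (All.map⁺ (All.map (λ {(b , Q)} Q≤ → ℕ.≤-trans (cutoff-≤ v b Q) (ℕ.≤-trans Q≤ (IsUniform.Q≤M uniform)))
      (cumulative-≤ 0 s)))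
    (subst (_≤ _) (sym (trans (List.length-map (uncurry (cutoff v)) (cumulative 0 s)) (cumulative-length 0 s)))
      (IsUniform.k≤m uniform))

  module _ {v : List ℚ} (val : Valuation v) (k : ℕ) {s : Strategy} (sd : StrictlyDecreasing s)
           (cs : List ℚ) (enough : suc k ≤ length cs) where

    private
      bids = bidVector s
      x = units (suc k) cs bids
      p = price (suc k) cs bids
      k<length : k < length (bids ++ cs)
      k<length = ℕ.≤-trans enough (subst (length cs ≤_) (sym (List.length-++ bids)) (ℕ.m≤n+m _ _))

    reaching-target : 1 ≤ x → p ℚ.≤ avg v x →
                      Any (Reaches v (suc k) cs x) (blockEnds s) ⊎ Any (Reaches v (suc k) cs x) (blockCutoffs v s)
    reaching-target 1≤x p≤avg with find (winning-block 0 s sd refl 1≤x)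
    ... | (b , Q) , bQ∈ , wb with b ≤? avg v x
    ...   | yes b≤avg = inj₂ (lose (∈-map⁺ (uncurry (cutoff v)) bQ∈) (x≤y , ℕ.≤-trans
              (ℕ.+-monoʳ-≤ x (countAbove-anti (≤-avg-cutoff v b Q (ℕ.≤-trans 1≤x x≤y)) cs)) (WinningBlock.fits wb)))
      where
      x≤y : x ≤ cutoff v b Q
      x≤y = cutoff-maximal v b Q 1≤x (WinningBlock.x≤Q wb) b≤avg
    ...   | no  b≰avg with WinningBlock.whole wb
    ...     | inj₁ refl = inj₁ (lose (∈-map⁺ proj₂ bQ∈) (ℕ.≤-refl , ℕ.m≤n⇒m≤1+n (begin
              x + countAbove (avg v x) cs      ≤⟨ ℕ.+-mono-≤ x≤above (countAbove-anti p≤avg cs) ⟩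
              countAbove p bids + countAbove p cs ≡⟨ count-++ (p <?_) bids cs ⟨
              countAbove p (bids ++ cs)       ≤⟨ countAbove-price k cs bids k<length ⟩
              k                               ∎)))
      where
      open ℕ.≤-Reasoning
      x≤above : x ≤ countAbove p bids
      x≤above = ℕ.≤-trans (cumulative-countAtLeast 0 sd bQ∈)
                  (countAtLeast≤countAbove (ℚ.≤-<-trans p≤avg (ℚ.≰⇒> b≰avg)) bids)
    ...     | inj₂ K≤ = contradiction (ℚ.≤-<-trans p≤avg (ℚ.≰⇒> b≰avg)) (ℚ-≤⇒≯ (≤-price k cs bids (begin
              suc k                                   ≤⟨ K≤ ⟩
              Q + countAbove b cs                     ≤⟨ ℕ.+-mono-≤ (cumulative-countAtLeast 0 sd bQ∈)
                                                                    (countAbove≤countAtLeast b cs) ⟩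
              countAtLeast b bids + countAtLeast b cs ≡⟨ count-++ (b ≤?_) bids cs ⟨
              countAtLeast b (bids ++ cs)             ∎)))
      where open ℕ.≤-Reasoning

    private
      sE = pbarOf v (blockEnds s)
      sC = pbarOf v (blockCutoffs v s)

      value-nonneg : ∀ s′ → 0ℚ ℚ.≤ value (suc k) v s′ cs
      value-nonneg s′ = sumℚ-nonneg (All.take⁺ (units (suc k) cs (bidVector s′)) (nonneg val))

      value-≥ : ∀ {ys} → Linked _≤_ ys → 1 ≤ x → Any (Reaches v (suc k) cs x) ys →
                sumℚ (take x v) ℚ.≤ value (suc k) v (pbarOf v ys) cs
      value-≥ sorted 1≤x reach = sumℚ-take-mono (nonneg val) (pbarOf-wins v sorted 1≤x reach)

      matched : 1 ≤ x → p ℚ.≤ avg v x → sumℚ (take x v) ℚ.≤ value (suc k) v sE cs ℚ.+ value (suc k) v sC cs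
      matched 1≤x p≤avg with reaching-target 1≤x p≤avg
      ... | inj₁ reach = ℚ.≤-trans (value-≥ (blockEnds-sorted sd) 1≤x reach)
                           (ℚ.≤-trans (ℚ.≤-reflexive (sym (ℚ.+-identityʳ vE))) (ℚ.+-monoʳ-≤ vE (value-nonneg sC)))
        where vE = value (suc k) v sE cs
      ... | inj₂ reach = ℚ.≤-trans (value-≥ (blockCutoffs-sorted v sd) 1≤x reach)
                           (ℚ.≤-trans (ℚ.≤-reflexive (sym (ℚ.+-identityˡ vC))) (ℚ.+-monoˡ-≤ vC (value-nonneg sE)))
        where vC = value (suc k) v sC cs

    round-value : payment (suc k) s cs ℚ.≤ value (suc k) v s cs →
                  value (suc k) v s cs ℚ.≤ value (suc k) v sE cs ℚ.+ value (suc k) v sC cs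
    round-value roi with x in x≡
    ... | zero  = ℚ.+-mono-≤ (value-nonneg sE) (value-nonneg sC)
    ... | suc n = subst (λ y → sumℚ (take y v) ℚ.≤ value (suc k) v sE cs ℚ.+ value (suc k) v sC cs) x≡
                    (matched (subst (1 ≤_) (sym x≡) (s≤s z≤n))
                      (subst (λ y → p ℚ.≤ avg v y) (sym x≡) (≤-*-1/suc p n _ roi)))

  upper-bound : ∀ m → 1 ≤ m → (K : ℕ) → 1 ≤ K → (v : List ℚ) → Valuation v →
                (H : History) → ValidHistory K H → (s : Strategy) → InF K m v H s →
                ∃[ s′ ] (InPbar m v s′ × totalValue K v H s ℚ.≤ ι 2 ℚ.* totalValue K v H s′)
  upper-bound m 1≤m (suc k) _ v val H valid s (uniform , feasible) =
    larger (ℚ.≤-total (total sE) (total sC))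
    where
    sE = pbarOf v (blockEnds s)
    sC = pbarOf v (blockCutoffs v s)
    total = totalValue (suc k) v H
    split : total s ℚ.≤ total sE ℚ.+ total sC
    split = sumℚ-map-≤-+ (value (suc k) v s) (value (suc k) v sE) (value (suc k) v sC)
      (All.zipWith (λ { {cs} ((enough , _) , roi) → round-value val k (IsUniform.strictDec uniform) cs enough roi })
        (valid , feasible))
    larger : total sE ℚ.≤ total sC ⊎ total sC ℚ.≤ total sE →
             ∃[ s′ ] (InPbar m v s′ × total s ℚ.≤ ι 2 ℚ.* total s′)
    larger (inj₁ E≤C) = sC , blockCutoffs-InPbar val 1≤m uniform , ℚ.≤-trans split (+-≤-2* E≤C)
    larger (inj₂ C≤E) = sE , blockEnds-InPbar val 1≤m uniform ,
      ℚ.≤-trans split (ℚ.≤-trans (ℚ.≤-reflexive (ℚ.+-comm (total sE) (total sC))) (+-≤-2* C≤E))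

module NaturalSums where

  open import Data.Nat.Base using (ℕ; zero; suc; z≤n; s≤s; _+_; _*_; _^_; _≤_; _<_; _≥_)
  import Data.Nat.Properties as ℕ
  open import Data.Nat.ListAction using (sum)
  open import Data.List.Base using (List; []; _∷_; _++_; length; take; map; replicate)
  open import Data.List.Relation.Unary.Linked using (Linked; []; [-]; _∷_)
  open import Data.Sum.Base using (inj₁; inj₂)
  open import Relation.Nullary using (¬_; Dec; yes; no)
  open import Relation.Nullary.Negation using (contradiction)
  open import Relation.Binary.PropositionalEquality
  open import Algebra.Properties.CommutativeSemigroup ℕ.+-commutativeSemigroup using (interchange)

  sumFrom : (ℕ → ℕ) → ℕ → ℕ → ℕ
  sumFrom f i zero    = 0
  sumFrom f i (suc r) = f i + sumFrom f (suc i) r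

  sumFrom-mono : ∀ {f g} i r → (∀ {k} → i ≤ k → k < i + r → f k ≤ g k) → sumFrom f i r ≤ sumFrom g i r
  sumFrom-mono i zero    _  = z≤n
  sumFrom-mono i (suc r) f≤g = ℕ.+-mono-≤ (f≤g ℕ.≤-refl (ℕ.m<m+n i (s≤s z≤n)))
    (sumFrom-mono (suc i) r λ {k} i<k k< → f≤g (ℕ.<⇒≤ i<k) (subst (k <_) (sym (ℕ.+-suc i r)) k<))

  sumFrom-cong : ∀ {f g} i r → (∀ {k} → i ≤ k → k < i + r → f k ≡ g k) → sumFrom f i r ≡ sumFrom g i r
  sumFrom-cong i zero    _   = refl
  sumFrom-cong i (suc r) f≡g = cong₂ _+_ (f≡g ℕ.≤-refl (ℕ.m<m+n i (s≤s z≤n)))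
    (sumFrom-cong (suc i) r λ {k} i<k k< → f≡g (ℕ.<⇒≤ i<k) (subst (k <_) (sym (ℕ.+-suc i r)) k<))

  sumFrom-const : ∀ a i r → sumFrom (λ _ → a) i r ≡ r * a
  sumFrom-const a i zero    = refl
  sumFrom-const a i (suc r) = cong (a +_) (sumFrom-const a (suc i) r)

  sumFrom-+ : ∀ f g i r → sumFrom (λ k → f k + g k) i r ≡ sumFrom f i r + sumFrom g i r
  sumFrom-+ f g i zero    = refl
  sumFrom-+ f g i (suc r) = trans (cong (f i + g i +_) (sumFrom-+ f g (suc i) r))
    (interchange (f i) (g i) (sumFrom f (suc i) r) (sumFrom g (suc i) r))

  sumFrom-* : ∀ a f i r → sumFrom (λ k → a * f k) i r ≡ a * sumFrom f i r
  sumFrom-* a f i zero    = sym (ℕ.*-zeroʳ a)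
  sumFrom-* a f i (suc r) = trans (cong (a * f i +_) (sumFrom-* a f (suc i) r)) (sym (ℕ.*-distribˡ-+ a (f i) _))

  sumFrom-suc : ∀ f i r → sumFrom f i (suc r) ≡ sumFrom f i r + f (i + r)
  sumFrom-suc f i zero    = trans (ℕ.+-identityʳ (f i)) (cong f (sym (ℕ.+-identityʳ i)))
  sumFrom-suc f i (suc r) = begin
    f i + sumFrom f (suc i) (suc r)        ≡⟨ cong (f i +_) (sumFrom-suc f (suc i) r) ⟩
    f i + (sumFrom f (suc i) r + f (suc i + r)) ≡⟨ ℕ.+-assoc (f i) _ _ ⟨
    f i + sumFrom f (suc i) r + f (suc i + r)   ≡⟨ cong (λ k → f i + sumFrom f (suc i) r + f k) (ℕ.+-suc i r) ⟨
    f i + sumFrom f (suc i) r + f (i + suc r)   ∎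
    where open ≡-Reasoning

  module _ (c : ℕ) where

    private
      B = suc (suc c)

    geometric : ∀ a n → suc c * sumFrom (λ i → B ^ (a + i)) 0 n + B ^ a ≡ B ^ (a + n)
    geometric a zero    = trans (cong (_+ B ^ a) (ℕ.*-zeroʳ (suc c))) (cong (B ^_) (sym (ℕ.+-identityʳ a)))
    geometric a (suc n) = begin
      suc c * S′ + B ^ a                                  ≡⟨ cong (λ t → suc c * t + B ^ a) (sumFrom-suc (λ i → B ^ (a + i)) 0 n) ⟩
      suc c * (S + B ^ (a + n)) + B ^ a                   ≡⟨ cong (_+ B ^ a) (ℕ.*-distribˡ-+ (suc c) S _) ⟩
      suc c * S + suc c * B ^ (a + n) + B ^ a             ≡⟨ ℕ.+-assoc (suc c * S) _ _ ⟩
      suc c * S + (suc c * B ^ (a + n) + B ^ a)           ≡⟨ cong (suc c * S +_) (ℕ.+-comm _ (B ^ a)) ⟩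
      suc c * S + (B ^ a + suc c * B ^ (a + n))           ≡⟨ ℕ.+-assoc (suc c * S) _ _ ⟨
      suc c * S + B ^ a + suc c * B ^ (a + n)             ≡⟨ cong (_+ suc c * B ^ (a + n)) (geometric a n) ⟩
      B ^ (a + n) + suc c * B ^ (a + n)                   ≡⟨⟩
      B ^ suc (a + n)                                     ≡⟨ cong (B ^_) (ℕ.+-suc a n) ⟨
      B ^ (a + suc n)                                     ∎
      where
      open ≡-Reasoning
      S = sumFrom (λ i → B ^ (a + i)) 0 n
      S′ = sumFrom (λ i → B ^ (a + i)) 0 (suc n)

  at : List ℕ → ℕ → ℕ
  at []       _       = 0
  at (x ∷ xs) zero    = x
  at (x ∷ xs) (suc n) = at xs n

  prefixSum : List ℕ → ℕ → ℕ
  prefixSum u y = sum (take y u)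

  prefixSum-suc : ∀ u y → prefixSum u (suc y) ≡ prefixSum u y + at u y
  prefixSum-suc []       zero    = refl
  prefixSum-suc []       (suc y) = refl
  prefixSum-suc (x ∷ xs) zero    = ℕ.+-comm x 0
  prefixSum-suc (x ∷ xs) (suc y) = trans (cong (x +_) (prefixSum-suc xs y)) (sym (ℕ.+-assoc x _ _))

  prefixSum-mono : ∀ u {i j} → i ≤ j → prefixSum u i ≤ prefixSum u j
  prefixSum-mono u {j = zero}  z≤n = z≤n
  prefixSum-mono u {i} {suc j} i≤1+j with ℕ.m≤n⇒m<n∨m≡n i≤1+j
  ... | inj₂ refl       = ℕ.≤-refl
  ... | inj₁ (s≤s i≤j)  = ℕ.≤-trans (prefixSum-mono u i≤j)
                            (subst (prefixSum u j ≤_) (sym (prefixSum-suc u j)) (ℕ.m≤m+n _ _))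

  module _ {u : List ℕ} (desc : Linked _≥_ u) where

    at-suc-≤ : ∀ y → at u (suc y) ≤ at u y
    at-suc-≤ y = go desc y
      where
      go : ∀ {u} → Linked _≥_ u → ∀ y → at u (suc y) ≤ at u y
      go []          _       = z≤n
      go [-]         zero    = z≤n
      go [-]         (suc _) = z≤n
      go (x≥y ∷ _)   zero    = x≥y
      go (_ ∷ d)     (suc y) = go d y

    at-antitone : ∀ {i j} → i ≤ j → at u j ≤ at u i
    at-antitone {j = zero}  z≤n = ℕ.≤-refl
    at-antitone {i} {suc j} i≤1+j with ℕ.m≤n⇒m<n∨m≡n i≤1+j
    ... | inj₂ refl      = ℕ.≤-refl
    ... | inj₁ (s≤s i≤j) = ℕ.≤-trans (at-suc-≤ j) (at-antitone i≤j)

    prefixSum-≤-* : ∀ y → prefixSum u y ≤ y * at u 0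
    prefixSum-≤-* zero    = z≤n
    prefixSum-≤-* (suc y) = begin
      prefixSum u (suc y)   ≡⟨ prefixSum-suc u y ⟩
      prefixSum u y + at u y ≤⟨ ℕ.+-mono-≤ (prefixSum-≤-* y) (at-antitone z≤n) ⟩
      y * at u 0 + at u 0   ≡⟨ ℕ.+-comm _ (at u 0) ⟩
      suc y * at u 0        ∎
      where open ℕ.≤-Reasoning

    prefixSum-subadditive : ∀ a b → prefixSum u (a + b) ≤ prefixSum u a + prefixSum u b
    prefixSum-subadditive a zero    = ℕ.≤-reflexive (trans (cong (prefixSum u) (ℕ.+-identityʳ a)) (sym (ℕ.+-identityʳ _)))
    prefixSum-subadditive a (suc b) = begin
      prefixSum u (a + suc b)                 ≡⟨ cong (prefixSum u) (ℕ.+-suc a b) ⟩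
      prefixSum u (suc (a + b))               ≡⟨ prefixSum-suc u (a + b) ⟩
      prefixSum u (a + b) + at u (a + b)      ≤⟨ ℕ.+-mono-≤ (prefixSum-subadditive a b) (at-antitone (ℕ.m≤n+m b a)) ⟩
      prefixSum u a + prefixSum u b + at u b  ≡⟨ ℕ.+-assoc (prefixSum u a) _ _ ⟩
      prefixSum u a + (prefixSum u b + at u b) ≡⟨ cong (prefixSum u a +_) (prefixSum-suc u b) ⟨
      prefixSum u a + prefixSum u (suc b)     ∎
      where open ℕ.≤-Reasoning

    module _ (strict-head : ∀ y → 1 ≤ y → at u y < at u 0) where

      *-at-<-prefixSum : ∀ y → 1 ≤ y → y * at u y < prefixSum u y
      *-at-<-prefixSum (suc zero) _ = begin-strict
        1 * at u 1        ≡⟨ ℕ.*-identityˡ (at u 1) ⟩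
        at u 1            <⟨ strict-head 1 (s≤s z≤n) ⟩
        at u 0            ≡⟨ prefixSum-suc u 0 ⟨
        prefixSum u 1     ∎
        where open ℕ.≤-Reasoning
      *-at-<-prefixSum (suc (suc n)) _ = begin-strict
        suc (suc n) * at u (suc (suc n))      ≤⟨ ℕ.*-monoʳ-≤ (suc (suc n)) (at-suc-≤ (suc n)) ⟩
        suc (suc n) * at u (suc n)            ≡⟨⟩
        at u (suc n) + suc n * at u (suc n)   <⟨ ℕ.+-monoʳ-< (at u (suc n)) (*-at-<-prefixSum (suc n) (s≤s z≤n)) ⟩
        at u (suc n) + prefixSum u (suc n)    ≡⟨ ℕ.+-comm (at u (suc n)) _ ⟩
        prefixSum u (suc n) + at u (suc n)    ≡⟨ prefixSum-suc u (suc n) ⟨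
        prefixSum u (suc (suc n))             ∎
        where open ℕ.≤-Reasoning

      prefixSum-average-step : ∀ n → prefixSum u (suc (suc n)) * suc n < prefixSum u (suc n) * suc (suc n)
      prefixSum-average-step n = begin-strict
        prefixSum u (suc (suc n)) * suc n                       ≡⟨ cong (_* suc n) (prefixSum-suc u (suc n)) ⟩
        (prefixSum u (suc n) + at u (suc n)) * suc n            ≡⟨ ℕ.*-distribʳ-+ (suc n) (prefixSum u (suc n)) _ ⟩
        prefixSum u (suc n) * suc n + at u (suc n) * suc n      <⟨ ℕ.+-monoʳ-< (prefixSum u (suc n) * suc n)
                                                                     (subst (_< prefixSum u (suc n)) (ℕ.*-comm (suc n) _)
                                                                       (*-at-<-prefixSum (suc n) (s≤s z≤n))) ⟩
        prefixSum u (suc n) * suc n + prefixSum u (suc n)       ≡⟨ ℕ.+-comm _ (prefixSum u (suc n)) ⟩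
        prefixSum u (suc n) + prefixSum u (suc n) * suc n       ≡⟨ ℕ.*-suc (prefixSum u (suc n)) (suc n) ⟨
        prefixSum u (suc n) * suc (suc n)                       ∎
        where open ℕ.≤-Reasoning

  prefixSum-++ : ∀ xs ys n → prefixSum (xs ++ ys) (length xs + n) ≡ sum xs + prefixSum ys n
  prefixSum-++ []       ys n = refl
  prefixSum-++ (x ∷ xs) ys n = trans (cong (x +_) (prefixSum-++ xs ys n)) (sym (ℕ.+-assoc x (sum xs) _))

  indicator : ∀ {A : Set} → Dec A → ℕ
  indicator (yes _) = 1
  indicator (no  _) = 0

  indicator-yes : ∀ {A : Set} (d : Dec A) → A → indicator d ≡ 1
  indicator-yes (yes _) _ = refl
  indicator-yes (no ¬a) a = contradiction a ¬a

  indicator-no : ∀ {A : Set} (d : Dec A) → ¬ A → indicator d ≡ 0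
  indicator-no (yes a) ¬a = contradiction a ¬a
  indicator-no (no  _) _  = refl

  indicator-≤-1 : ∀ {A : Set} (d : Dec A) → indicator d ≤ 1
  indicator-≤-1 (yes _) = ℕ.≤-refl
  indicator-≤-1 (no  _) = z≤n

  *-sum-map-≤ : ∀ {A : Set} a b (f : A → ℕ) xs → (∀ x → a * f x ≤ b) → a * sum (map f xs) ≤ length xs * b
  *-sum-map-≤ a b f []       _     = ℕ.≤-reflexive (ℕ.*-zeroʳ a)
  *-sum-map-≤ a b f (x ∷ xs) bound = ℕ.≤-trans (ℕ.≤-reflexive (ℕ.*-distribˡ-+ a (f x) _))
    (ℕ.+-mono-≤ (bound x) (*-sum-map-≤ a b f xs bound))

  double : ℕ → ℕ
  double zero    = zero
  double (suc n) = suc (suc (double n))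

  double-mono : ∀ {i j} → i ≤ j → double i ≤ double j
  double-mono z≤n       = z≤n
  double-mono (s≤s i≤j) = s≤s (s≤s (double-mono i≤j))

  double-< : ∀ {i j} → i < j → suc (double i) < double j
  double-< {i} {suc j} (s≤s i≤j) = s≤s (s≤s (double-mono i≤j))

  data Parity : ℕ → Set where
    even : ∀ j → Parity (double j)
    odd  : ∀ j → Parity (suc (double j))

  parity : ∀ k → Parity k
  parity zero = even 0
  parity (suc k) with parity k
  ... | even j = odd j
  ... | odd  j = even (suc j)

  sum-replicate : ∀ n a → sum (replicate n a) ≡ n * a
  sum-replicate zero    a = refl
  sum-replicate (suc n) a = cong (a +_) (sum-replicate n a)

module LowerBound where

  open import Defs
  open Rationals
  open Auctions
  open UpperBound using (cumulative; cumulative-length; blockEnds)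
  open NaturalSums
  open import Data.Nat.Base using (ℕ; zero; suc; z≤n; s≤s; _+_; _*_; _∸_; _^_; _≤_; _<_; _≥_)
  import Data.Nat.Properties as ℕ
  open import Data.Nat.ListAction using (sum)
  open import Data.Nat.ListAction.Properties using (sum-++)
  open import Data.Nat.Solver using (module +-*-Solver)
  open import Data.Rational.Base as ℚ using (ℚ; 0ℚ)
  import Data.Rational.Properties as ℚ
  open import Data.Rational.Properties using (_<?_; _≤?_)
  open import Data.List.Base using (List; []; _∷_; _++_; length; take; map; replicate; filter)
  import Data.List.Properties as List
  open import Data.List.Relation.Unary.All as All using (All; []; _∷_)
  import Data.List.Relation.Unary.All.Properties as All
  open import Data.List.Relation.Unary.Linked using (Linked; []; [-]; _∷_)
  import Data.List.Relation.Unary.Linked as Linked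
  import Data.List.Relation.Unary.Linked.Properties as Linked
  open import Data.Product.Base using (_×_; _,_; proj₁; proj₂; ∃-syntax)
  open import Data.Sum.Base using (inj₁; inj₂)
  open import Relation.Nullary using (¬_; Dec; yes; no)
  open import Relation.Unary using (Decidable)
  open import Relation.Binary.PropositionalEquality
  open import Algebra.Properties.CommutativeSemigroup ℕ.*-commutativeSemigroup using () renaming (interchange to *-interchange)

  module Instance (m′ c : ℕ) where

    m B T : ℕ
    m = suc m′
    B = suc (suc c)
    T = double m

    width unitValue multiplicity : ℕ → ℕ
    width k        = B ^ double k
    unitValue k    = B ^ (T ∸ k)
    multiplicity k = B ^ (T ∸ k)

    position : ℕ → ℕ
    position = sumFrom width 0

    blocks : ℕ → ℕ → List ℕ
    blocks i zero    = []
    blocks i (suc r) = replicate (width i) (unitValue i) ++ blocks (suc i) r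

    u : List ℕ
    u = blocks 0 T

    v : List ℚ
    v = map ι u

    M K : ℕ
    M = position T
    K = suc M

    w : ℕ → ℚ
    w = avg v

    high : ℚ
    high = ι (suc (unitValue 0))

    1<B : 1 < B
    1<B = s≤s (s≤s z≤n)

    width-pos : ∀ k → 1 ≤ width k
    width-pos k = ℕ.m^n>0 B (double k)

    unitValue-anti : ∀ {i j} → i ≤ j → unitValue j ≤ unitValue i
    unitValue-anti i≤j = ℕ.^-monoʳ-≤ B (ℕ.∸-monoʳ-≤ T i≤j)

    length-blocks : ∀ i r → length (blocks i r) ≡ sumFrom width i r
    length-blocks i zero    = refl
    length-blocks i (suc r) = trans (List.length-++ (replicate (width i) (unitValue i)))
      (cong₂ _+_ (List.length-replicate (width i)) (length-blocks (suc i) r))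

    blocks-≤ : ∀ i r → All (_≤ unitValue i) (blocks i r)
    blocks-≤ i zero    = []
    blocks-≤ i (suc r) = All.++⁺ (All.replicate⁺ (width i) ℕ.≤-refl)
      (All.map (λ le → ℕ.≤-trans le (unitValue-anti (ℕ.n≤1+n i))) (blocks-≤ (suc i) r))

    blocks-descending : ∀ i r → Linked _≥_ (blocks i r)
    blocks-descending i zero    = []
    blocks-descending i (suc r) = Linked-replicate-++ ℕ.≤-refl (width i)
      (All.map (λ le → ℕ.≤-trans le (unitValue-anti (ℕ.n≤1+n i))) (blocks-≤ (suc i) r)) (blocks-descending (suc i) r)

    blocks-pos : ∀ i r → All (1 ≤_) (blocks i r)
    blocks-pos i zero    = []
    blocks-pos i (suc r) = All.++⁺ (All.replicate⁺ (width i) (ℕ.m^n>0 B (T ∸ i))) (blocks-pos (suc i) r)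

    u-descending : Linked _≥_ u
    u-descending = blocks-descending 0 T

    at-≤ : ∀ {e xs} → All (_≤ e) xs → ∀ y → at xs y ≤ e
    at-≤ []         _       = z≤n
    at-≤ (x≤e ∷ _)  zero    = x≤e
    at-≤ (_ ∷ xs≤e) (suc y) = at-≤ xs≤e y

    at-<-head : ∀ y → 1 ≤ y → at u y < at u 0
    at-<-head (suc y) _ = ℕ.≤-<-trans (at-≤ (blocks-≤ 1 (suc (double m′))) y)
      (ℕ.^-monoʳ-< B 1<B (ℕ.n<1+n (suc (double m′))))

    length-v : length v ≡ M
    length-v = trans (List.length-map ι u) (length-blocks 0 T)

    valuation : Valuation v
    valuation = record
      { nonempty   = s≤s z≤n
      ; decreasing = Linked.map⁺ (Linked.map ι-mono-≤ u-descending)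
      ; positive   = All.map⁺ (All.map ι-mono-< (blocks-pos 0 T))
      }

    sumℚ-take-ι : ∀ y → sumℚ (take y v) ≡ ι (prefixSum u y)
    sumℚ-take-ι y = trans (cong sumℚ (List.take-map y u)) (ι-sum (take y u))

    w-suc : ∀ n → w (suc n) ≡ ι (prefixSum u (suc n)) ℚ.* 1/suc n
    w-suc n = cong (ℚ._* 1/suc n) (sumℚ-take-ι (suc n))

    w-step : ∀ {y} → 1 ≤ y → w (suc y) ℚ.< w y
    w-step {suc n} _ = subst₂ ℚ._<_ (sym (w-suc (suc n))) (sym (w-suc n))
      (frac-mono-< (prefixSum u (suc (suc n))) (suc n) (prefixSum u (suc n)) n
        (prefixSum-average-step u-descending at-<-head n))

    w-strict : ∀ {y y′} → 1 ≤ y → y < y′ → w y′ ℚ.< w y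
    w-strict = strictly-antitone w w-step

    w-antitone : ∀ {y y′} → 1 ≤ y → y ≤ y′ → w y′ ℚ.≤ w y
    w-antitone = antitone w w-step

    w-reflects : ∀ {x Q} → 1 ≤ x → w x ℚ.≤ w Q → Q ≤ x
    w-reflects = antitone-reflects w w-step

    w-pos : ∀ y → 1 ≤ y → 0ℚ ℚ.< w y
    w-pos (suc n) _ = avg-pos valuation n

    w<high : ∀ y → 1 ≤ y → w y ℚ.< high
    w<high (suc n) _ = ℚ.≤-<-trans (subst₂ ℚ._≤_ (sym (w-suc n)) (*-1/suc-zero (unitValue 0))
      (frac-mono-≤ (prefixSum u (suc n)) n (unitValue 0) 0
        (subst₂ _≤_ (sym (ℕ.*-identityʳ _)) (ℕ.*-comm (suc n) _) (prefixSum-≤-* u-descending (suc n)))))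
      (ι-mono-< (ℕ.n<1+n (unitValue 0)))

    position-suc : ∀ k → position (suc k) ≡ position k + width k
    position-suc = sumFrom-suc width 0

    position-<-suc : ∀ k → position k < position (suc k)
    position-<-suc k = subst (position k <_) (sym (position-suc k)) (ℕ.m<m+n (position k) (width-pos k))

    position-< : ∀ {i j} → i < j → position i < position j
    position-< {i} {suc j} (s≤s i≤j) with ℕ.m≤n⇒m<n∨m≡n i≤j
    ... | inj₂ refl = position-<-suc i
    ... | inj₁ i<j  = ℕ.<-trans (position-< i<j) (position-<-suc j)

    position-mono : ∀ {i j} → i ≤ j → position i ≤ position j
    position-mono i≤j with ℕ.m≤n⇒m<n∨m≡n i≤j
    ... | inj₁ i<j  = ℕ.<⇒≤ (position-< i<j)
    ... | inj₂ refl = ℕ.≤-refl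

    bid : ℕ → ℚ
    bid j = w (position (suc (double j)))

    feasibleLevels : ℕ → ℕ → Strategy
    feasibleLevels j zero    = []
    feasibleLevels j (suc r) = (bid j , width (double j) + width (suc (double j))) ∷ feasibleLevels (suc j) r

    feasible : Strategy
    feasible = feasibleLevels 0 m

    feasibleLevels-++ : ∀ j r r′ → feasibleLevels j (r + r′) ≡ feasibleLevels j r ++ feasibleLevels (j + r) r′
    feasibleLevels-++ j zero    r′ = cong (λ i → feasibleLevels i r′) (sym (ℕ.+-identityʳ j))
    feasibleLevels-++ j (suc r) r′ = cong (_ ∷_)
      (trans (feasibleLevels-++ (suc j) r r′) (cong (λ i → feasibleLevels (suc j) r ++ feasibleLevels i r′) (sym (ℕ.+-suc j r))))

    totalQ-feasibleLevels : ∀ j r → totalQ (feasibleLevels j r) ≡ sumFrom width (double j) (double r)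
    totalQ-feasibleLevels j zero    = refl
    totalQ-feasibleLevels j (suc r) =
      trans (cong (width (double j) + width (suc (double j)) +_) (totalQ-feasibleLevels (suc j) r))
            (ℕ.+-assoc (width (double j)) _ _)

    length-feasibleLevels : ∀ j r → length (feasibleLevels j r) ≡ r
    length-feasibleLevels j zero    = refl
    length-feasibleLevels j (suc r) = cong suc (length-feasibleLevels (suc j) r)

    feasibleLevels-bids : ∀ {P : ℚ → Set} j r → (∀ {i} → j ≤ i → i < j + r → P (bid i)) →
                       All (λ p → P (proj₁ p)) (feasibleLevels j r)
    feasibleLevels-bids j zero    _ = []
    feasibleLevels-bids j (suc r) P-bid = P-bid ℕ.≤-refl (ℕ.m<m+n j (s≤s z≤n))
      ∷ feasibleLevels-bids (suc j) r (λ {i} j<i i< → P-bid (ℕ.<⇒≤ j<i) (subst (i <_) (sym (ℕ.+-suc j r)) i<))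

    bid-strict : ∀ {i j} → i < j → bid j ℚ.< bid i
    bid-strict i<j = w-strict (s≤s z≤n) (position-< (s≤s (ℕ.<⇒≤ (double-< i<j))))

    feasibleLevels-strictlyDecreasing : ∀ j r → StrictlyDecreasing (feasibleLevels j r)
    feasibleLevels-strictlyDecreasing j zero          = []
    feasibleLevels-strictlyDecreasing j (suc zero)    = [-]
    feasibleLevels-strictlyDecreasing j (suc (suc r)) =
      bid-strict (ℕ.n<1+n j) ∷ feasibleLevels-strictlyDecreasing (suc j) (suc r)

    quantities-pos : ∀ j r → All (λ p → 1 ≤ proj₂ p) (feasibleLevels j r)
    quantities-pos j zero    = []
    quantities-pos j (suc r) = ℕ.≤-trans (width-pos (double j)) (ℕ.m≤m+n _ _) ∷ quantities-pos (suc j) r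

    feasible-uniform : IsUniform m v feasible
    feasible-uniform = record
      { kpos      = s≤s z≤n
      ; k≤m       = ℕ.≤-reflexive (length-feasibleLevels 0 m)
      ; strictDec = feasibleLevels-strictlyDecreasing 0 m
      ; bidsPos   = feasibleLevels-bids 0 m (λ {i} _ _ → w-pos (position (suc (double i))) (s≤s z≤n))
      ; qtyPos    = quantities-pos 0 m
      ; Q≤M       = ℕ.≤-reflexive (trans (totalQ-feasibleLevels 0 m) (sym length-v))
      }

    count-feasible : ∀ {P : ℚ → Set} (P? : Decidable P) ℓ → ℓ ≤ m →
              (∀ {i} → i < ℓ → P (bid i)) → (∀ {i} → ℓ ≤ i → i < m → ¬ P (bid i)) →
              length (filter P? (bidVector feasible)) ≡ position (double ℓ)
    count-feasible P? ℓ ℓ≤m below above = begin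
      length (filter P? (bidVector feasible))                    ≡⟨ cong (λ s → length (filter P? (bidVector s))) F≡ ⟩
      length (filter P? (bidVector (pre ++ post)))        ≡⟨ cong (λ bs → length (filter P? bs)) (bidVector-++ pre post) ⟩
      length (filter P? (bidVector pre ++ bidVector post)) ≡⟨ count-++ P? (bidVector pre) (bidVector post) ⟩
      length (filter P? (bidVector pre)) + length (filter P? (bidVector post))
        ≡⟨ cong₂ _+_ (count-all P? (bidVector-All (feasibleLevels-bids 0 ℓ (λ _ i<ℓ → below i<ℓ))))
                     (count-none P? (bidVector-All (feasibleLevels-bids ℓ (m ∸ ℓ) (λ {i} ℓ≤i i< → above ℓ≤i (subst (i <_) m≡ i<))))) ⟩
      length (bidVector pre) + 0                           ≡⟨ ℕ.+-identityʳ _ ⟩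
      length (bidVector pre)                               ≡⟨ length-bidVector pre ⟩
      totalQ pre                                           ≡⟨ totalQ-feasibleLevels 0 ℓ ⟩
      position (double ℓ)                                  ∎
      where
      open ≡-Reasoning
      pre = feasibleLevels 0 ℓ
      post = feasibleLevels ℓ (m ∸ ℓ)
      m≡ : ℓ + (m ∸ ℓ) ≡ m
      m≡ = ℕ.m+[n∸m]≡n ℓ≤m
      F≡ : feasible ≡ pre ++ post
      F≡ = trans (cong (feasibleLevels 0) (sym m≡)) (feasibleLevels-++ 0 ℓ (m ∸ ℓ))

    target : ℕ → ℕ
    target k = position (suc k)

    -- One high rival bid fewer in the odd rounds keeps the K-th highest bid at the rival
    -- bid w x rather than at a bid of the feasible strategy.
    extra : ℕ → ℕ
    extra zero          = 0
    extra (suc zero)    = 1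
    extra (suc (suc k)) = extra k

    extra-even : ∀ j → extra (double j) ≡ 0
    extra-even zero    = refl
    extra-even (suc j) = extra-even j

    extra-odd : ∀ j → extra (suc (double j)) ≡ 1
    extra-odd zero    = refl
    extra-odd (suc j) = extra-odd j

    round : ℕ → List ℚ
    round k = rivals (K ∸ extra k ∸ target k) high K (w (target k))

    private
      w-≤-bid : ∀ x i → position (suc (double i)) ≤ x → w x ℚ.≤ bid i
      w-≤-bid x i = w-antitone (s≤s z≤n)

      w-<-bid : ∀ x i → position (suc (double i)) < x → w x ℚ.< bid i
      w-<-bid x i = w-strict (s≤s z≤n)

      bid-≤-w : ∀ x i → 1 ≤ x → x ≤ position (suc (double i)) → bid i ℚ.≤ w x
      bid-≤-w x i = w-antitone

      bid-<-w : ∀ x i → 1 ≤ x → x < position (suc (double i)) → bid i ℚ.< w x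
      bid-<-w x i = w-strict

      feasible-descending : Descending (bidVector feasible)
      feasible-descending = bidVector-descending (feasibleLevels-strictlyDecreasing 0 m)

      feasible<high : All (ℚ._< high) (bidVector feasible)
      feasible<high = bidVector-All (feasibleLevels-bids 0 m (λ {i} _ _ → w<high (position (suc (double i))) (s≤s z≤n)))

    feasible-partial-round : ∀ {j} → j < m →
                      units K (round (double j)) (bidVector feasible) ≡ target (double j) ×
                      price K (round (double j)) (bidVector feasible) ≡ w (target (double j))
    feasible-partial-round {j} j<m =
      rivals-round {k = M} {h = K ∸ extra (double j) ∸ x} {hi = high} {a = w x} {x = x} {bs = bidVector feasible}
        feasible-descending feasible<high (w<high x (s≤s z≤n))
        (subst (x ≤_) (sym atLeast) (position-mono (ℕ.n≤1+n (suc (double j)))))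
        (subst (λ e → x + (K ∸ e ∸ x) ≤ K) (sym (extra-even j)) (ℕ.≤-reflexive x+[K∸x]≡K))
        (subst (λ e → countAbove (w x) (bidVector feasible) + (K ∸ e ∸ x) ≤ M) (sym (extra-even j))
          (subst (λ n → n + (K ∸ x) ≤ M) (sym above)
            (ℕ.≤-pred (subst (position (double j) + (K ∸ x) <_) x+[K∸x]≡K
              (ℕ.+-monoˡ-< (K ∸ x) (position-<-suc (double j)))))))
        (inj₂ (subst (λ e → K ≤ x + (K ∸ e ∸ x)) (sym (extra-even j)) (ℕ.≤-reflexive (sym x+[K∸x]≡K))))
      where
      x = target (double j)
      x+[K∸x]≡K : x + (K ∸ x) ≡ K
      x+[K∸x]≡K = ℕ.m+[n∸m]≡n (ℕ.m≤n⇒m≤1+n (position-mono (ℕ.<⇒≤ (double-< j<m))))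
      atLeast : countAtLeast (w x) (bidVector feasible) ≡ position (double (suc j))
      atLeast = count-feasible (w x ≤?_) (suc j) j<m
        (λ {i} i<1+j → w-≤-bid x i (position-mono (s≤s (double-mono (ℕ.≤-pred i<1+j)))))
        (λ {i} j<i _ le → ℚ-≤⇒≯ le (bid-<-w x i (s≤s z≤n) (position-< (s≤s (ℕ.<⇒≤ (double-< j<i))))))
      above : countAbove (w x) (bidVector feasible) ≡ position (double j)
      above = count-feasible (w x <?_) j (ℕ.<⇒≤ j<m)
        (λ {i} i<j → w-<-bid x i (position-< (s≤s (ℕ.<⇒≤ (double-< i<j)))))
        (λ {i} j≤i _ lt → ℚ-≤⇒≯ (bid-≤-w x i (s≤s z≤n) (position-mono (s≤s (double-mono j≤i)))) lt)

    feasible-full-round : ∀ {j} → j < m →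
                   units K (round (suc (double j))) (bidVector feasible) ≡ target (suc (double j)) ×
                   price K (round (suc (double j))) (bidVector feasible) ≡ w (target (suc (double j)))
    feasible-full-round {j} j<m =
      rivals-round {k = M} {h = K ∸ extra (suc (double j)) ∸ x} {hi = high} {a = w x} {x = x} {bs = bidVector feasible}
        feasible-descending feasible<high (w<high x (s≤s z≤n))
        (ℕ.≤-reflexive (sym atLeast))
        (subst (λ e → x + (K ∸ e ∸ x) ≤ K) (sym (extra-odd j)) (ℕ.m≤n⇒m≤1+n (ℕ.≤-reflexive x+[M∸x]≡M)))
        (subst (λ e → countAbove (w x) (bidVector feasible) + (K ∸ e ∸ x) ≤ M) (sym (extra-odd j))
          (ℕ.≤-reflexive (trans (cong (_+ (M ∸ x)) above) x+[M∸x]≡M)))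
        (inj₁ (ℕ.≤-reflexive atLeast))
      where
      x = target (suc (double j))
      x+[M∸x]≡M : x + (M ∸ x) ≡ M
      x+[M∸x]≡M = ℕ.m+[n∸m]≡n (position-mono (double-mono j<m))
      atLeast : countAtLeast (w x) (bidVector feasible) ≡ x
      atLeast = count-feasible (w x ≤?_) (suc j) j<m
        (λ {i} i<1+j → w-≤-bid x i (position-mono (s≤s (ℕ.m≤n⇒m≤1+n (double-mono (ℕ.≤-pred i<1+j))))))
        (λ {i} j<i _ le → ℚ-≤⇒≯ le (bid-<-w x i (s≤s z≤n) (position-< (s≤s (double-mono j<i)))))
      above : countAbove (w x) (bidVector feasible) ≡ x
      above = count-feasible (w x <?_) (suc j) j<m
        (λ {i} i<1+j → w-<-bid x i (position-< (s≤s (s≤s (double-mono (ℕ.≤-pred i<1+j))))))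
        (λ {i} j<i _ lt → ℚ-≤⇒≯ (bid-≤-w x i (s≤s z≤n) (position-mono (ℕ.m≤n⇒m≤1+n (double-mono j<i)))) lt)

    feasible-round : ∀ {k} → k < T → units K (round k) (bidVector feasible) ≡ target k × price K (round k) (bidVector feasible) ≡ w (target k)
    feasible-round {k} = by-parity (parity k)
      where
      by-parity : ∀ {k} → Parity k → k < T →
                  units K (round k) (bidVector feasible) ≡ target k × price K (round k) (bidVector feasible) ≡ w (target k)
      by-parity (even j) k<T = feasible-partial-round (ℕ.≰⇒> (λ m≤j → ℕ.<⇒≱ k<T (double-mono m≤j)))
      by-parity (odd  j) k<T = feasible-full-round (ℕ.≰⇒> (λ m≤j → ℕ.<⇒≱ k<T (ℕ.m≤n⇒m≤1+n (double-mono m≤j))))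

    roundsFrom : ℕ → ℕ → History
    roundsFrom i zero    = []
    roundsFrom i (suc r) = replicate (multiplicity i) (round i) ++ roundsFrom (suc i) r

    history : History
    history = roundsFrom 0 T

    roundsFrom-All : ∀ {P : List ℚ → Set} i r → (∀ {k} → i ≤ k → k < i + r → P (round k)) → All P (roundsFrom i r)
    roundsFrom-All i zero    _       = []
    roundsFrom-All i (suc r) P-round = All.++⁺ (All.replicate⁺ (multiplicity i) (P-round ℕ.≤-refl (ℕ.m<m+n i (s≤s z≤n))))
      (roundsFrom-All (suc i) r (λ {k} i<k k< → P-round (ℕ.<⇒≤ i<k) (subst (k <_) (sym (ℕ.+-suc i r)) k<)))

    sum-roundsFrom : ∀ (f : List ℚ → ℕ) i r → sum (map f (roundsFrom i r)) ≡ sumFrom (λ k → multiplicity k * f (round k)) i r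
    sum-roundsFrom f i zero    = refl
    sum-roundsFrom f i (suc r) = begin
      sum (map f (replicate (multiplicity i) (round i) ++ roundsFrom (suc i) r))
        ≡⟨ cong sum (List.map-++ f (replicate (multiplicity i) (round i)) _) ⟩
      sum (map f (replicate (multiplicity i) (round i)) ++ map f (roundsFrom (suc i) r))
        ≡⟨ sum-++ (map f (replicate (multiplicity i) (round i))) _ ⟩
      sum (map f (replicate (multiplicity i) (round i))) + sum (map f (roundsFrom (suc i) r))
        ≡⟨ cong₂ _+_ (trans (cong sum (List.map-replicate f (multiplicity i) (round i))) (sum-replicate (multiplicity i) (f (round i))))
                     (sum-roundsFrom f (suc i) r) ⟩
      multiplicity i * f (round i) + sumFrom (λ k → multiplicity k * f (round k)) (suc i) r ∎
      where open ≡-Reasoning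

    history-valid : ValidHistory K history
    history-valid = roundsFrom-All 0 T λ {k} _ _ →
      subst (K ≤_) (sym (trans (List.length-++ (replicate (K ∸ extra k ∸ target k) high))
                               (cong₂ _+_ (List.length-replicate (K ∸ extra k ∸ target k)) (List.length-replicate K))))
            (ℕ.m≤n+m K (K ∸ extra k ∸ target k)) ,
      All.++⁺ (All.replicate⁺ (K ∸ extra k ∸ target k) (ℚ.<⇒≤ (ℚ.<-trans (w-pos (target k) (s≤s z≤n)) (w<high (target k) (s≤s z≤n)))))
              (All.replicate⁺ K (ℚ.<⇒≤ (w-pos (target k) (s≤s z≤n))))

    feasible-roi : RoIFeasible K v history feasible
    feasible-roi = roundsFrom-All 0 T λ {k} _ k<T → ℚ.≤-reflexive (begin
      price K (round k) bids ℚ.* ι (units K (round k) bids)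
        ≡⟨ cong₂ (λ p n → p ℚ.* ι n) (proj₂ (feasible-round k<T)) (proj₁ (feasible-round k<T)) ⟩
      w (target k) ℚ.* ι (target k)
        ≡⟨ *-1/suc-*-ι (sumℚ (take (target k) v)) (sumFrom width 1 k) ⟩
      sumℚ (take (target k) v)
        ≡⟨ cong (λ n → sumℚ (take n v)) (sym (proj₁ (feasible-round k<T))) ⟩
      value K v feasible (round k) ∎)
      where
      open ≡-Reasoning
      bids = bidVector feasible

    historyValue : Strategy → ℕ
    historyValue s = sumFrom (λ k → multiplicity k * prefixSum u (units K (round k) (bidVector s))) 0 T

    totalValue-history : ∀ s → totalValue K v history s ≡ ι (historyValue s)
    totalValue-history s = begin
      sumℚ (map (value K v s) history)                 ≡⟨ cong sumℚ (List.map-cong (λ cs → sumℚ-take-ι (won cs)) history) ⟩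
      sumℚ (map (λ cs → ι (prefixSum u (won cs))) history) ≡⟨ cong sumℚ (List.map-∘ history) ⟩
      sumℚ (map ι (map (λ cs → prefixSum u (won cs)) history)) ≡⟨ ι-sum (map (λ cs → prefixSum u (won cs)) history) ⟩
      ι (sum (map (λ cs → prefixSum u (won cs)) history)) ≡⟨ cong ι (sum-roundsFrom (λ cs → prefixSum u (won cs)) 0 T) ⟩
      ι (sumFrom (λ k → multiplicity k * prefixSum u (won (round k))) 0 T) ∎
      where
      open ≡-Reasoning
      won : List ℚ → ℕ
      won cs = units K cs (bidVector s)

    double≡+ : ∀ n → double n ≡ n + n
    double≡+ zero    = refl
    double≡+ (suc n) = cong suc (trans (cong suc (double≡+ n)) (sym (ℕ.+-suc n n)))

    width*unitValue : ∀ {j} → j ≤ T → width j * unitValue j ≡ B ^ (T + j)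
    width*unitValue {j} j≤T = begin
      B ^ double j * B ^ (T ∸ j)  ≡⟨ ℕ.^-distribˡ-+-* B (double j) (T ∸ j) ⟨
      B ^ (double j + (T ∸ j))    ≡⟨ cong (B ^_) (begin
        double j + (T ∸ j)          ≡⟨ cong (_+ (T ∸ j)) (double≡+ j) ⟩
        j + j + (T ∸ j)             ≡⟨ ℕ.+-assoc j j (T ∸ j) ⟩
        j + (j + (T ∸ j))           ≡⟨ cong (j +_) (ℕ.m+[n∸m]≡n j≤T) ⟩
        j + T                       ≡⟨ ℕ.+-comm j T ⟩
        T + j                       ∎) ⟩
      B ^ (T + j)                 ∎
      where open ≡-Reasoning

    prefixSum-blocks : ∀ i k r → k ≤ r → prefixSum (blocks i r) (sumFrom width i k) ≡ sumFrom (λ j → width j * unitValue j) i k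
    prefixSum-blocks i zero    r       _         = refl
    prefixSum-blocks i (suc k) (suc r) (s≤s k≤r) = begin
      prefixSum (replicate (width i) (unitValue i) ++ blocks (suc i) r) (width i + sumFrom width (suc i) k)
        ≡⟨ cong (λ n → prefixSum (replicate (width i) (unitValue i) ++ blocks (suc i) r) (n + sumFrom width (suc i) k))
                (List.length-replicate (width i)) ⟨
      prefixSum (replicate (width i) (unitValue i) ++ blocks (suc i) r)
                (length (replicate (width i) (unitValue i)) + sumFrom width (suc i) k)
        ≡⟨ prefixSum-++ (replicate (width i) (unitValue i)) (blocks (suc i) r) _ ⟩
      sum (replicate (width i) (unitValue i)) + prefixSum (blocks (suc i) r) (sumFrom width (suc i) k)
        ≡⟨ cong₂ _+_ (sum-replicate (width i) (unitValue i)) (prefixSum-blocks (suc i) k r k≤r) ⟩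
      width i * unitValue i + sumFrom (λ j → width j * unitValue j) (suc i) k ∎
      where open ≡-Reasoning

    prefixSum-position : ∀ {k} → k ≤ T → prefixSum u (position k) ≡ sumFrom (λ i → B ^ (T + i)) 0 k
    prefixSum-position {k} k≤T = trans (prefixSum-blocks 0 k T k≤T)
      (sumFrom-cong 0 k (λ {j} _ j<k → trans (width*unitValue (ℕ.≤-trans (ℕ.<⇒≤ j<k) k≤T)) refl))

    feasible-total : T * B ^ (T + T) ≤ historyValue feasible
    feasible-total = begin
      T * B ^ (T + T)                  ≡⟨ sumFrom-const (B ^ (T + T)) 0 T ⟨
      sumFrom (λ _ → B ^ (T + T)) 0 T  ≤⟨ sumFrom-mono 0 T (λ {k} _ k<T → per-type k<T) ⟩
      historyValue feasible ∎
      where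
      open ℕ.≤-Reasoning
      per-type : ∀ {k} → k < T → B ^ (T + T) ≤ multiplicity k * prefixSum u (units K (round k) (bidVector feasible))
      per-type {k} k<T = begin
        B ^ (T + T)                           ≡⟨ cong (B ^_) (begin-equality
          T + T                                 ≡⟨ cong (_+ T) (ℕ.m∸n+n≡m (ℕ.<⇒≤ k<T)) ⟨
          T ∸ k + k + T                         ≡⟨ ℕ.+-assoc (T ∸ k) k T ⟩
          T ∸ k + (k + T)                       ≡⟨ cong (T ∸ k +_) (ℕ.+-comm k T) ⟩
          T ∸ k + (T + k)                       ∎) ⟩
        B ^ (T ∸ k + (T + k))                 ≡⟨ ℕ.^-distribˡ-+-* B (T ∸ k) (T + k) ⟩
        multiplicity k * B ^ (T + k)          ≤⟨ ℕ.*-monoʳ-≤ (multiplicity k) (ℕ.≤-trans (ℕ.m≤n+m (B ^ (T + k)) (sumFrom (λ i → B ^ (T + i)) 0 k))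
                                                   (ℕ.≤-reflexive (trans (sym (sumFrom-suc (λ i → B ^ (T + i)) 0 k)) (sym (prefixSum-position k<T))))) ⟩
        multiplicity k * prefixSum u (target k) ≡⟨ cong (λ n → multiplicity k * prefixSum u n) (proj₁ (feasible-round k<T)) ⟨
        multiplicity k * prefixSum u (units K (round k) (bidVector feasible)) ∎

    reachedValue : List ℕ → ℕ → ℕ
    reachedValue []       x = 0
    reachedValue (Q ∷ Qs) x = indicator (Q ℕ.≤? x) * prefixSum u Q + reachedValue Qs x

    prefixSum-countAtLeast : ∀ acc s → BidsAreAvgs v acc s → ∀ {x} → 1 ≤ x →
                             prefixSum u (countAtLeast (w x) (bidVector s)) ≤ reachedValue (map proj₂ (cumulative acc s)) x
    prefixSum-countAtLeast acc []            _            _   = z≤n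
    prefixSum-countAtLeast acc ((b , q) ∷ s) (b≡ , avgs) {x} 1≤x = begin
      prefixSum u (countAtLeast (w x) (replicate q b ++ bidVector s))
        ≡⟨ cong (prefixSum u) (count-++ (w x ≤?_) (replicate q b) (bidVector s)) ⟩
      prefixSum u (countAtLeast (w x) (replicate q b) + countAtLeast (w x) (bidVector s))
        ≤⟨ prefixSum-subadditive u-descending (countAtLeast (w x) (replicate q b)) (countAtLeast (w x) (bidVector s)) ⟩
      prefixSum u (countAtLeast (w x) (replicate q b)) + prefixSum u (countAtLeast (w x) (bidVector s))
        ≤⟨ ℕ.+-mono-≤ (own-block (w x ≤? b)) (prefixSum-countAtLeast (acc + q) s avgs 1≤x) ⟩
      indicator (acc + q ℕ.≤? x) * prefixSum u (acc + q) + reachedValue (map proj₂ (cumulative (acc + q) s)) x ∎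
      where
      open ℕ.≤-Reasoning
      own-block : Dec (w x ℚ.≤ b) → prefixSum u (countAtLeast (w x) (replicate q b)) ≤
                                     indicator (acc + q ℕ.≤? x) * prefixSum u (acc + q)
      own-block (yes wx≤b) = begin
        prefixSum u (countAtLeast (w x) (replicate q b)) ≡⟨ cong (prefixSum u) (count-replicate (w x ≤?_) q wx≤b) ⟩
        prefixSum u q                                  ≤⟨ prefixSum-mono u (ℕ.m≤n+m q acc) ⟩
        prefixSum u (acc + q)                          ≡⟨ ℕ.*-identityˡ _ ⟨
        1 * prefixSum u (acc + q)                      ≡⟨ cong (_* prefixSum u (acc + q))
                                                            (indicator-yes (acc + q ℕ.≤? x) (w-reflects 1≤x (subst (w x ℚ.≤_) b≡ wx≤b))) ⟨
        indicator (acc + q ℕ.≤? x) * prefixSum u (acc + q) ∎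
      own-block (no wx≰b) = subst (λ n → prefixSum u n ≤ _) (sym (count-none (w x ≤?_) (All.replicate⁺ q wx≰b))) z≤n

    multiplicity-geometric : ∀ i r → i + r ≡ T → suc c * sumFrom multiplicity i r + B ≡ B ^ suc r
    multiplicity-geometric i zero    _     = trans (cong (_+ B) (ℕ.*-zeroʳ (suc c))) (sym (ℕ.*-identityʳ B))
    multiplicity-geometric i (suc r) i+r≡T = begin
      suc c * (multiplicity i + sumFrom multiplicity (suc i) r) + B
        ≡⟨ cong (_+ B) (ℕ.*-distribˡ-+ (suc c) (multiplicity i) _) ⟩
      suc c * multiplicity i + suc c * sumFrom multiplicity (suc i) r + B
        ≡⟨ ℕ.+-assoc (suc c * multiplicity i) _ B ⟩
      suc c * multiplicity i + (suc c * sumFrom multiplicity (suc i) r + B)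
        ≡⟨ cong₂ (λ e n → suc c * B ^ e + n) T∸i (multiplicity-geometric (suc i) r (trans (sym (ℕ.+-suc i r)) i+r≡T)) ⟩
      suc c * B ^ suc r + B ^ suc r
        ≡⟨ ℕ.+-comm (suc c * B ^ suc r) _ ⟩
      B ^ suc (suc r) ∎
      where
      open ≡-Reasoning
      T∸i : T ∸ i ≡ suc r
      T∸i = trans (cong (_∸ i) (sym i+r≡T)) (ℕ.m+n∸m≡n i (suc r))

    roundsReaching : ℕ → ℕ → ℕ → ℕ
    roundsReaching Q = sumFrom (λ k → multiplicity k * indicator (Q ℕ.≤? target k))

    perLevelBound : ℕ
    perLevelBound = B ^ (T + T) * (B * B)

    roundsReaching-bound : ∀ {Q} i r → i + r ≡ T → position i < Q →
                           suc c * suc c * (prefixSum u Q * roundsReaching Q i r) ≤ perLevelBound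
    roundsReaching-bound {Q} i zero _ _ =
      subst (_≤ perLevelBound) (sym (trans (cong (suc c * suc c *_) (ℕ.*-zeroʳ (prefixSum u Q))) (ℕ.*-zeroʳ (suc c * suc c)))) z≤n
    roundsReaching-bound {Q} i (suc r) i+r≡T i<Q = case (Q ℕ.≤? target i)
      where
      open ℕ.≤-Reasoning
      case : Dec (Q ≤ target i) → suc c * suc c * (prefixSum u Q * roundsReaching Q i (suc r)) ≤ perLevelBound
      case (yes Q≤) = begin
        suc c * suc c * (prefixSum u Q * roundsReaching Q i (suc r))
          ≤⟨ ℕ.*-monoʳ-≤ (suc c * suc c) (ℕ.*-mono-≤ (prefixSum-mono u Q≤)
               (sumFrom-mono i (suc r) (λ {k} _ _ → ℕ.≤-trans (ℕ.*-monoʳ-≤ (multiplicity k) (indicator-≤-1 (Q ℕ.≤? target k)))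
                                                     (ℕ.≤-reflexive (ℕ.*-identityʳ _))))) ⟩
        suc c * suc c * (prefixSum u (target i) * sumFrom multiplicity i (suc r))
          ≡⟨ *-interchange (suc c) (suc c) (prefixSum u (target i)) (sumFrom multiplicity i (suc r)) ⟩
        (suc c * prefixSum u (target i)) * (suc c * sumFrom multiplicity i (suc r))
          ≤⟨ ℕ.*-mono-≤ (ℕ.≤-trans (ℕ.m≤m+n (suc c * prefixSum u (target i)) (B ^ T)) (ℕ.≤-reflexive (trans
               (cong (λ n → suc c * n + B ^ T) (prefixSum-position 1+i≤T)) (geometric c T (suc i)))))
             (ℕ.≤-trans (ℕ.m≤m+n (suc c * sumFrom multiplicity i (suc r)) B) (ℕ.≤-reflexive (multiplicity-geometric i (suc r) i+r≡T))) ⟩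
        B ^ (T + suc i) * B ^ suc (suc r)
          ≡⟨ ℕ.^-distribˡ-+-* B (T + suc i) (suc (suc r)) ⟨
        B ^ (T + suc i + suc (suc r))
          ≡⟨ cong (B ^_) exponent ⟩
        B ^ (T + T + 2)
          ≡⟨ ℕ.^-distribˡ-+-* B (T + T) 2 ⟩
        B ^ (T + T) * (B * (B * 1))
          ≡⟨ cong (λ b → B ^ (T + T) * (B * b)) (ℕ.*-identityʳ B) ⟩
        perLevelBound ∎
        where
        1+i≤T : suc i ≤ T
        1+i≤T = subst (suc i ≤_) i+r≡T (subst (_≤ i + suc r) (ℕ.+-comm i 1) (ℕ.+-monoʳ-≤ i (s≤s z≤n)))
        exponent : T + suc i + suc (suc r) ≡ T + T + 2
        exponent = begin-equality
          T + suc i + suc (suc r)       ≡⟨ ℕ.+-assoc T (suc i) _ ⟩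
          T + suc (i + suc (suc r))     ≡⟨ cong (λ n → T + suc n) (trans (ℕ.+-suc i (suc r)) (cong suc i+r≡T)) ⟩
          T + (2 + T)                   ≡⟨ cong (T +_) (ℕ.+-comm 2 T) ⟩
          T + (T + 2)                   ≡⟨ ℕ.+-assoc T T 2 ⟨
          T + T + 2                     ∎
      case (no Q≰) = subst (_≤ perLevelBound) (cong (λ n → suc c * suc c * (prefixSum u Q * n)) (sym tail≡))
        (roundsReaching-bound (suc i) r (trans (sym (ℕ.+-suc i r)) i+r≡T) (ℕ.≰⇒> Q≰))
        where
        tail≡ : roundsReaching Q i (suc r) ≡ roundsReaching Q (suc i) r
        tail≡ = trans (cong (λ n → multiplicity i * n + roundsReaching Q (suc i) r) (indicator-no (Q ℕ.≤? target i) Q≰))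
                      (cong (_+ roundsReaching Q (suc i) r) (ℕ.*-zeroʳ (multiplicity i)))

    end-bound : ∀ Q → suc c * suc c * (prefixSum u Q * roundsReaching Q 0 T) ≤ perLevelBound
    end-bound zero    = subst (_≤ perLevelBound) (sym (ℕ.*-zeroʳ (suc c * suc c))) z≤n
    end-bound (suc Q) = roundsReaching-bound 0 T refl (s≤s z≤n)

    sumFrom-reached : ∀ Qs → sumFrom (λ k → multiplicity k * reachedValue Qs (target k)) 0 T ≡
                             sum (map (λ Q → prefixSum u Q * roundsReaching Q 0 T) Qs)
    sumFrom-reached [] = trans (sumFrom-cong 0 T (λ {k} _ _ → ℕ.*-zeroʳ (multiplicity k)))
                               (trans (sumFrom-const 0 0 T) (ℕ.*-zeroʳ T))
    sumFrom-reached (Q ∷ Qs) = begin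
      sumFrom (λ k → multiplicity k * (indicator (Q ℕ.≤? target k) * prefixSum u Q + reachedValue Qs (target k))) 0 T
        ≡⟨ sumFrom-cong 0 T (λ {k} _ _ → pointwise k) ⟩
      sumFrom (λ k → prefixSum u Q * (multiplicity k * indicator (Q ℕ.≤? target k))
                     + multiplicity k * reachedValue Qs (target k)) 0 T
        ≡⟨ sumFrom-+ (λ k → prefixSum u Q * (multiplicity k * indicator (Q ℕ.≤? target k)))
                     (λ k → multiplicity k * reachedValue Qs (target k)) 0 T ⟩
      sumFrom (λ k → prefixSum u Q * (multiplicity k * indicator (Q ℕ.≤? target k))) 0 T
        + sumFrom (λ k → multiplicity k * reachedValue Qs (target k)) 0 T
        ≡⟨ cong₂ _+_ (sumFrom-* (prefixSum u Q) _ 0 T) (sumFrom-reached Qs) ⟩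
      prefixSum u Q * roundsReaching Q 0 T + sum (map (λ Q → prefixSum u Q * roundsReaching Q 0 T) Qs) ∎
      where
      open ≡-Reasoning
      pointwise : ∀ k → multiplicity k * (indicator (Q ℕ.≤? target k) * prefixSum u Q + reachedValue Qs (target k)) ≡
                        prefixSum u Q * (multiplicity k * indicator (Q ℕ.≤? target k)) + multiplicity k * reachedValue Qs (target k)
      pointwise k = trans (ℕ.*-distribˡ-+ (multiplicity k) _ _) (cong (_+ multiplicity k * reachedValue Qs (target k))
        (trans (sym (ℕ.*-assoc (multiplicity k) _ (prefixSum u Q))) (ℕ.*-comm _ (prefixSum u Q))))

    pbar-round : ∀ {s′} → InPbar m v s′ → ∀ k →
                 prefixSum u (units K (round k) (bidVector s′)) ≤ reachedValue (blockEnds s′) (target k)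
    pbar-round {s′} (_ , avgs) k = ℕ.≤-trans
      (prefixSum-mono u (units-rivals-≤ (K ∸ extra k ∸ target k) high K (w (target k)) (bidVector s′)))
      (prefixSum-countAtLeast 0 s′ avgs (s≤s z≤n))

    pbar-total : ∀ {s′} → InPbar m v s′ →
                 suc c * suc c * historyValue s′ ≤ m * perLevelBound
    pbar-total {s′} pbar = begin
      suc c * suc c * historyValue s′
        ≤⟨ ℕ.*-monoʳ-≤ (suc c * suc c) (sumFrom-mono 0 T (λ {k} _ _ → ℕ.*-monoʳ-≤ (multiplicity k) (pbar-round pbar k))) ⟩
      suc c * suc c * sumFrom (λ k → multiplicity k * reachedValue (blockEnds s′) (target k)) 0 T
        ≡⟨ cong (suc c * suc c *_) (sumFrom-reached (blockEnds s′)) ⟩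
      suc c * suc c * sum (map (λ Q → prefixSum u Q * roundsReaching Q 0 T) (blockEnds s′))
        ≤⟨ *-sum-map-≤ (suc c * suc c) perLevelBound _ (blockEnds s′) end-bound ⟩
      length (blockEnds s′) * perLevelBound
        ≤⟨ ℕ.*-monoˡ-≤ perLevelBound (subst (_≤ m) (sym (trans (List.length-map proj₂ (cumulative 0 s′)) (cumulative-length 0 s′)))
                              (IsUniform.k≤m (proj₁ pbar))) ⟩
      m * perLevelBound ∎
      where open ℕ.≤-Reasoning

    pbar-≤-feasible : ∀ {s′} → InPbar m v s′ → (c + c) * historyValue s′ ≤ B * historyValue feasible
    pbar-≤-feasible {s′} pbar = ℕ.*-cancelˡ-≤ (suc c * suc c) (begin
      suc c * suc c * ((c + c) * historyValue s′)
        ≡⟨ solve 3 (λ a c x → a :* ((c :+ c) :* x) := (c :+ c) :* (a :* x)) refl (suc c * suc c) c (historyValue s′) ⟩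
      (c + c) * (suc c * suc c * historyValue s′)
        ≤⟨ ℕ.*-monoʳ-≤ (c + c) (pbar-total pbar) ⟩
      (c + c) * (m * perLevelBound)
        ≡⟨ solve 4 (λ c m p b → (c :+ c) :* (m :* (p :* (b :* b))) := c :* b :* (b :* ((m :+ m) :* p))) refl c m (B ^ (T + T)) B ⟩
      c * B * (B * ((m + m) * B ^ (T + T)))
        ≡⟨ cong (λ t → c * B * (B * (t * B ^ (T + T)))) (double≡+ m) ⟨
      c * B * (B * (T * B ^ (T + T)))
        ≤⟨ ℕ.*-mono-≤ (ℕ.≤-trans (ℕ.m≤m+n (c * B) 1) (ℕ.≤-reflexive (solve 1 (λ c → c :* (con 2 :+ c) :+ con 1 := (con 1 :+ c) :* (con 1 :+ c)) refl c)))
                      (ℕ.*-monoʳ-≤ B feasible-total) ⟩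
      suc c * suc c * (B * historyValue feasible) ∎)
      where
      open ℕ.≤-Reasoning
      open +-*-Solver

  tightness : ∀ m → 1 ≤ m → (δ : ℚ) → 0ℚ ℚ.< δ → δ ℚ.≤ 1/suc 1 →
              ∃[ K ] ∃[ v ] ∃[ H ] ∃[ s ]
                (1 ≤ K × Valuation v × ValidHistory K H × InF K m v H s × 0ℚ ℚ.< totalValue K v H s ×
                 (∀ s′ → InPbar m v s′ → (ι 2 ℚ.- δ) ℚ.* totalValue K v H s′ ℚ.≤ totalValue K v H s))
  tightness (suc m′) _ δ δ>0 _ with archimedean-4 δ δ>0
  ... | c , 4≤δB = K , v , history , feasible , s≤s z≤n , valuation , history-valid , (feasible-uniform , feasible-roi) , positive , bound
    where
    open Instance m′ c
    positive : 0ℚ ℚ.< totalValue K v history feasible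
    positive = subst (0ℚ ℚ.<_) (sym (totalValue-history feasible))
      (ι-mono-< (ℕ.≤-trans (ℕ.*-mono-≤ {1} {T} {1} (s≤s z≤n) (ℕ.m^n>0 B (T + T))) feasible-total))
    bound : ∀ s′ → InPbar (suc m′) v s′ → (ι 2 ℚ.- δ) ℚ.* totalValue K v history s′ ℚ.≤ totalValue K v history feasible
    bound s′ pbar = subst₂ (λ a b → (ι 2 ℚ.- δ) ℚ.* a ℚ.≤ b) (sym (totalValue-history s′)) (sym (totalValue-history feasible))
      (two-minus-≤ δ c (historyValue s′) (historyValue feasible) 4≤δB (pbar-≤-feasible pbar))

open import Defs
open import Data.Nat using (ℕ)
open import Data.Integer using (+_)
open import Data.Rational using (ℚ; 0ℚ; _*_; _-_; _/_; _≤_; _<_)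
open import Data.List using (List)
open import Data.Product using (_×_; ∃-syntax; _,_)
open UpperBound using (upper-bound)
open LowerBound using (tightness)

mainTheorem8 : (m : ℕ) → 1 Data.Nat.≤ m →
    -- upper bound: Λ_{F_m, Pbar_{≤m}}(H, v) ≤ 2 for every K, v, H
    ((K : ℕ) → 1 Data.Nat.≤ K → (v : List ℚ) → Valuation v →
      (H : History) → ValidHistory K H →
      (s : Strategy) → InF K m v H s →
      ∃[ s' ] (InPbar m v s' ×
        totalValue K v H s ≤ ((+ 2) / 1) * totalValue K v H s'))
    ×
    -- tightness: for every δ ∈ (0, 1/2] some instance has ratio ≥ 2 - δ
    ((δ : ℚ) → 0ℚ < δ → δ ≤ (+ 1) / 2 →
      ∃[ K ] ∃[ v ] ∃[ H ] ∃[ s ]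
        ((1 Data.Nat.≤ K) × Valuation v × ValidHistory K H × InF K m v H s ×
         (0ℚ < totalValue K v H s) ×
         ((s' : Strategy) → InPbar m v s' →
           (((+ 2) / 1) - δ) * totalValue K v H s' ≤ totalValue K v H s)))
mainTheorem8 m 1≤m = upper-bound m 1≤m , tightness m 1≤m
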